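{- Let $w\in\widetilde{S}_n$ and let $\beta$, $a_1,\dots,a_r$, $G_\beta$, $H_{i,\beta}$ and $H_\beta$ be as in the context. Then each $H_{i,\beta}$ ($1\le i\le r$) is connected, and hence $H_\beta$ has at least $n-r$ edges.
   Context: $\widetilde{S}_n$ is the set of bijections $w:\mathbb{Z}\to\mathbb{Z}$ with $w(i+n)=w(i)+n$ and $\sum_{i=1}^n w(i)=\binom{n+1}{2}$; write $w_i=w(i)$. For integers $a<b$, $a\not\equiv b\pmod n$, $t_{a,b}$ interchanges $a+cn$ and $b+cn$ for all $c$ and fixes other integers; $\ell$ is the Coxeter length ($\ell(w)=\#\{(a,b):1\le a\le n,\ a<b,\ w_a>w_b\}$). Fix $\beta\in\mathbb{Z}$ with $w_i<w_\beta$ for all $i<\beta$, and let $a_1<\dots<a_r$ be the indices of the left-to-right maxima of $w_\beta,\dots,w_{\beta+n-1}$ (indices $c$ in this window with $w_c>w_e$ for all $\beta\le e<c$; $a_1=\beta$). $G_\beta$ is the graph with vertex set $V_\beta=\{j\in\mathbb{Z}: j\ge\beta,\ w_j\le w_{a_r}\}$ and edge set $E_\beta=\{(j,k)\in V_\beta\times V_\beta:\beta\le j<\beta+n,\ j<k,\ \ell(wt_{j,k})=\ell(w)-1\}$. For $1\le i\le r-1$, $H_{i,\beta}$ is the induced subgraph of $G_\beta$ on the vertices $\{j: a_i\le j<a_{i+1}\}$, and $H_{r,\beta}$ is the induced subgraph on $V_\beta\cap\{j:a_r\le j<\beta+n\}$; $H_\beta=H_{1,\beta}\cup\dots\cup H_{r,\beta}$.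 -}

module Defs where

open import Data.Nat as ℕ using (ℕ; zero; suc; NonZero)
open import Data.Nat.Combinatorics using (_C_)
open import Data.Integer as ℤ using (ℤ; +_; _+_; _-_; _≤_; _<_; _%ℕ_)
open import Data.Fin as Fin using (Fin)
open import Data.List using (List; foldr; map; upTo; length)
open import Data.List.Membership.Propositional using (_∈_)
open import Data.List.Relation.Unary.Unique.Propositional using (Unique)
open import Data.List.Relation.Unary.All using (All)
open import Data.Product using (Σ; ∃; _×_; _,_)
open import Data.Sum using (_⊎_)
open import Data.Bool using (if_then_else_)
open import Relation.Nullary using (¬_; does)
open import Relation.Binary.PropositionalEquality using (_≡_; _≢_)
open import Function using (_∘_; _⇔_)

_≡[_]_ : ℤ → (n : ℕ) → .{{NonZero n}} → ℤ → Set
a ≡[ n ] b = a %ℕ n ≡ b %ℕ n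

windowSum : ℕ → (ℤ → ℤ) → ℤ
windowSum n w = foldr _+_ (+ 0) (map (λ i → w (+ suc i)) (upTo n))

record IsAffinePerm (n : ℕ) (w : ℤ → ℤ) : Set where
  field
    injective  : ∀ x y → w x ≡ w y → x ≡ y
    surjective : ∀ y → ∃ λ x → w x ≡ y
    periodic   : ∀ i → w (i + + n) ≡ w i + + n
    sumCond    : windowSum n w ≡ + (suc n C 2)

t : (n : ℕ) → .{{NonZero n}} → ℤ → ℤ → ℤ → ℤ
t n a b i =
  if does (i %ℕ n ℕ.≟ a %ℕ n) then i + (b - a)
  else if does (i %ℕ n ℕ.≟ b %ℕ n) then i - (b - a)
  else i

Inv : ℕ → (ℤ → ℤ) → ℤ × ℤ → Set
Inv n w (a , b) = + 1 ≤ a × a ≤ + n × a < b × w b < w a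

HasLength : ℕ → (ℤ → ℤ) → ℕ → Set
HasLength n w L = Σ (List (ℤ × ℤ)) λ xs →
  Unique xs × length xs ≡ L × (∀ p → (p ∈ xs) ⇔ Inv n w p)

-- ℓ(w t_{j,k}) = ℓ(w) - 1   (t_{j,k} only defined when j ≢ k mod n)
LengthDrop : (n : ℕ) → .{{NonZero n}} → (ℤ → ℤ) → ℤ → ℤ → Set
LengthDrop n w j k = ¬ (j ≡[ n ] k) ×
  Σ ℕ λ L → Σ ℕ λ L' → HasLength n w L × HasLength n (w ∘ t n j k) L' × L' ℕ.+ 1 ≡ L

IsLRM : ℕ → (ℤ → ℤ) → ℤ → ℤ → Set
IsLRM n w β c = β ≤ c × c < β + + n × (∀ e → β ≤ e → e < c → w e < w c)

last : ∀ {s} → (Fin (suc s) → ℤ) → ℤ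
last {s} a = a (Fin.fromℕ s)

-- a_{i+1} for i < r, and top for i = r
nxt : ∀ {s} → (Fin (suc s) → ℤ) → ℤ → Fin (suc s) → ℤ
nxt {zero}  a top Fin.zero    = top
nxt {suc s} a top Fin.zero    = a (Fin.suc Fin.zero)
nxt {suc s} a top (Fin.suc i) = nxt {s} (a ∘ Fin.suc) top i

V : (ℤ → ℤ) → ℤ → ℤ → ℤ → Set
V w β ar j = β ≤ j × w j ≤ w ar

E : (n : ℕ) → .{{NonZero n}} → (ℤ → ℤ) → ℤ → ℤ → ℤ → ℤ → Set
E n w β ar j k = V w β ar j × V w β ar k × β ≤ j × j < β + + n × j < k × LengthDrop n w j k

data Reach (R : ℤ → ℤ → Set) : ℤ → ℤ → Set where
  here : ∀ {x} → Reach R x x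
  step : ∀ {x y z} → (R x y ⊎ R y x) → Reach R y z → Reach R x z

Induced : (ℤ → Set) → (ℤ → ℤ → Set) → ℤ → ℤ → Set
Induced P R x y = P x × P y × R x y

Connected : (ℤ → Set) → (ℤ → ℤ → Set) → Set
Connected P R = ∀ x y → P x → P y → Reach (Induced P R) x y

AtLeastEdges : (ℤ × ℤ → Set) → ℕ → Set
AtLeastEdges R m = Σ (List (ℤ × ℤ)) λ xs → Unique xs × All R xs × m ℕ.≤ length xs

-- Inside a block every vertex x other than a_i has an edge back into the block: let e be the
-- last earlier position of the block with w e > w x (a_i qualifies, since a_i dominates its
-- block). Every value strictly between e and x lies below w x, and for such a covering
-- inversion ℓ(w t_{e,x}) = ℓ(w) − 1. Following these edges backwards reaches a_i, so each block
-- is connected, and the edges into the n − r positions of the window that are not left-to-right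
-- maxima are pairwise distinct.
--
-- The length drop is a counting argument: ℓ counts, for each position a of a window of n
-- consecutive positions, the later positions p + c·n (c ≥ 0) of smaller value. Swapping two
-- positions of the window only permutes the terms with c ≥ 1 (and no term with large c counts),
-- while among the inversions inside the window exactly one disappears for a covering pair.

module Submission where

module FiniteSums where

  open import Data.Nat as ℕ using (ℕ; zero; suc; _+_; _*_; _≤_; _<_; z≤n; s≤s; z<s)
  open import Data.Nat.Tactic.RingSolver using (solve-∀)
  open import Data.Nat.Properties
  open import Data.Fin as Fin using (Fin)
  open import Algebra.Properties.CommutativeSemigroup +-commutativeSemigroup using (interchange)
  open import Data.Empty using (⊥-elim)
  open import Function using (_∘_)
  open import Relation.Nullary using (Dec; yes; no; ¬_; ¬?)
  open import Relation.Binary.PropositionalEquality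

  ∑ : (ℕ → ℕ) → ℕ → ℕ → ℕ
  ∑ f lo zero    = 0
  ∑ f lo (suc m) = f lo + ∑ f (suc lo) m

  ∑-split : ∀ f lo a b → ∑ f lo (a + b) ≡ ∑ f lo a + ∑ f (lo + a) b
  ∑-split f lo zero    b = cong (λ x → ∑ f x b) (sym (+-identityʳ lo))
  ∑-split f lo (suc a) b rewrite ∑-split f (suc lo) a b | +-suc lo a = sym (+-assoc (f lo) _ _)

  ∑-snoc : ∀ f lo m → ∑ f lo (suc m) ≡ ∑ f lo m + f (lo + m)
  ∑-snoc f lo m = begin
    ∑ f lo (suc m)            ≡⟨ cong (∑ f lo) (+-comm 1 m) ⟩
    ∑ f lo (m + 1)            ≡⟨ ∑-split f lo m 1 ⟩
    ∑ f lo m + (f (lo + m) + 0) ≡⟨ cong (∑ f lo m +_) (+-identityʳ _) ⟩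
    ∑ f lo m + f (lo + m)     ∎
    where open ≡-Reasoning

  ∑-cong : ∀ {f g} lo m → (∀ i → lo ≤ i → i < lo + m → f i ≡ g i) → ∑ f lo m ≡ ∑ g lo m
  ∑-cong lo zero    eq = refl
  ∑-cong lo (suc m) eq = cong₂ _+_
    (eq lo ≤-refl (subst (lo <_) (sym (+-suc lo m)) (s≤s (m≤m+n lo m))))
    (∑-cong (suc lo) m λ i lo<i i<end → eq i (<⇒≤ lo<i) (subst (i <_) (sym (+-suc lo m)) i<end))

  ∑-cong′ : ∀ {f g} lo m → (∀ i → f i ≡ g i) → ∑ f lo m ≡ ∑ g lo m
  ∑-cong′ lo m eq = ∑-cong lo m (λ i _ _ → eq i)

  ∑-zero : ∀ f lo m → (∀ i → lo ≤ i → i < lo + m → f i ≡ 0) → ∑ f lo m ≡ 0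
  ∑-zero f lo zero    _  = refl
  ∑-zero f lo (suc m) eq = begin
    f lo + ∑ f (suc lo) m ≡⟨ cong₂ _+_ (eq lo ≤-refl (m<m+n lo z<s)) (∑-zero f (suc lo) m eq′) ⟩
    0                     ∎
    where
    open ≡-Reasoning
    eq′ : ∀ i → suc lo ≤ i → i < suc lo + m → f i ≡ 0
    eq′ i lo<i i<end = eq i (<⇒≤ lo<i) (subst (i <_) (sym (+-suc lo m)) i<end)

  ∑-one : ∀ lo m → ∑ (λ _ → 1) lo m ≡ m
  ∑-one lo zero    = refl
  ∑-one lo (suc m) = cong suc (∑-one (suc lo) m)

  ∑-distrib-+ : ∀ f g lo m → ∑ (λ i → f i + g i) lo m ≡ ∑ f lo m + ∑ g lo m
  ∑-distrib-+ f g lo zero    = refl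
  ∑-distrib-+ f g lo (suc m) rewrite ∑-distrib-+ f g (suc lo) m =
    interchange (f lo) (g lo) (∑ f (suc lo) m) (∑ g (suc lo) m)

  ∑-shift : ∀ f d lo m → ∑ (λ i → f (d + i)) lo m ≡ ∑ f (d + lo) m
  ∑-shift f d lo zero    = refl
  ∑-shift f d lo (suc m) rewrite ∑-shift f d (suc lo) m | +-suc d lo = refl

  ∑-chunks : ∀ f lo n c m → ∑ f (lo + c * n) (m * n) ≡ ∑ (λ c → ∑ f (lo + c * n) n) c m
  ∑-chunks f lo n c zero    = refl
  ∑-chunks f lo n c (suc m)
    rewrite ∑-split f (lo + c * n) n (m * n) | sym (∑-chunks f lo n (suc c) m)
          | +-assoc lo (c * n) n | +-comm (c * n) n = refl

  ∑-stagger : ∀ (f g : ℕ → ℕ) lo m →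
    ∑ (λ c → f c + g (suc c)) lo (suc m) ≡ f lo + ∑ (λ c → f c + g c) (suc lo) m + g (lo + suc m)
  ∑-stagger f g lo zero rewrite +-suc lo 0 | +-identityʳ lo
    | +-identityʳ (f lo + g (suc lo)) | +-identityʳ (f lo) = refl
  ∑-stagger f g lo (suc m) rewrite ∑-stagger f g (suc lo) m | +-suc lo (suc m) =
    rearrange (f lo) (g (suc lo)) (f (suc lo)) (∑ (λ c → f c + g c) (suc (suc lo)) m) (g (suc lo + suc m))
    where rearrange : ∀ a b c d e → a + b + (c + d + e) ≡ a + (c + b + d) + e
          rearrange = solve-∀

  ∑-mono : ∀ {f g} lo m → (∀ i → f i ≤ g i) → ∑ f lo m ≤ ∑ g lo m
  ∑-mono lo zero    f≤g = z≤n
  ∑-mono lo (suc m) f≤g = +-mono-≤ (f≤g lo) (∑-mono (suc lo) m f≤g)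

  term≤∑ : ∀ f lo m i → lo ≤ i → i < lo + m → f i ≤ ∑ f lo m
  term≤∑ f lo zero    i lo≤i i<lo = ⊥-elim (<⇒≱ i<lo (subst (_≤ i) (sym (+-identityʳ lo)) lo≤i))
  term≤∑ f lo (suc m) i lo≤i i<end with lo ≟ i
  ... | yes refl = m≤m+n (f lo) _
  ... | no lo≢i  = ≤-trans (term≤∑ f (suc lo) m i (≤∧≢⇒< lo≤i lo≢i) (subst (i <_) (+-suc lo m) i<end))
                           (m≤n+m _ (f lo))

  ∑ᶠ : ∀ {k} → (Fin k → ℕ) → ℕ
  ∑ᶠ {zero}  f = 0
  ∑ᶠ {suc k} f = f Fin.zero + ∑ᶠ (f ∘ Fin.suc)

  term≤∑ᶠ : ∀ {k} (f : Fin k → ℕ) i → f i ≤ ∑ᶠ f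
  term≤∑ᶠ f Fin.zero    = m≤m+n _ _
  term≤∑ᶠ f (Fin.suc i) = ≤-trans (term≤∑ᶠ (f ∘ Fin.suc) i) (m≤n+m _ _)

  ∑ᶠ-mono : ∀ {k} {f g : Fin k → ℕ} → (∀ i → f i ≤ g i) → ∑ᶠ f ≤ ∑ᶠ g
  ∑ᶠ-mono {zero}  f≤g = z≤n
  ∑ᶠ-mono {suc k} f≤g = +-mono-≤ (f≤g Fin.zero) (∑ᶠ-mono (f≤g ∘ Fin.suc))

  ∑ᶠ-one : ∀ k → ∑ᶠ {k} (λ _ → 1) ≡ k
  ∑ᶠ-one zero    = refl
  ∑ᶠ-one (suc k) = cong suc (∑ᶠ-one k)

  ∑-∑ᶠ-comm : ∀ {k} (f : ℕ → Fin k → ℕ) lo m → ∑ (λ o → ∑ᶠ (f o)) lo m ≡ ∑ᶠ (λ i → ∑ (λ o → f o i) lo m)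
  ∑-∑ᶠ-comm {zero}  f lo m = ∑-zero _ lo m (λ _ _ _ → refl)
  ∑-∑ᶠ-comm {suc k} f lo m = trans (∑-distrib-+ (λ o → f o Fin.zero) (λ o → ∑ᶠ (f o ∘ Fin.suc)) lo m)
    (cong (∑ (λ o → f o Fin.zero) lo m +_) (∑-∑ᶠ-comm (λ o → f o ∘ Fin.suc) lo m))

  indicator : ∀ {a} {P : Set a} → Dec P → ℕ
  indicator (yes _) = 1
  indicator (no _)  = 0

  indicator-yes : ∀ {a} {P : Set a} (d : Dec P) → P → indicator d ≡ 1
  indicator-yes (yes _) p = refl
  indicator-yes (no ¬p) p = ⊥-elim (¬p p)

  indicator-no : ∀ {a} {P : Set a} (d : Dec P) → ¬ P → indicator d ≡ 0
  indicator-no (yes p) ¬p = ⊥-elim (¬p p)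
  indicator-no (no _)  ¬p = refl

  indicator-cong : ∀ {a b} {P : Set a} {Q : Set b} (d : Dec P) (e : Dec Q) → (P → Q) → (Q → P) →
                   indicator d ≡ indicator e
  indicator-cong (yes p) (yes q) to from = refl
  indicator-cong (yes p) (no ¬q) to from = ⊥-elim (¬q (to p))
  indicator-cong (no ¬p) (yes q) to from = ⊥-elim (¬p (from q))
  indicator-cong (no ¬p) (no ¬q) to from = refl

  indicator-¬?-+ : ∀ {a} {P : Set a} (d : Dec P) → indicator (¬? d) + indicator d ≡ 1
  indicator-¬?-+ (yes _) = refl
  indicator-¬?-+ (no _)  = refl


module WindowInversions where

  open import Data.Nat as ℕ using (ℕ; suc; _+_; _≤_; _<_; s≤s)
  open import Data.Nat.Properties
  open import Data.Nat.Tactic.RingSolver using (solve-∀)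
  open import Data.Integer as ℤ using (ℤ; +_)
  import Data.Integer.Properties as ℤP
  open import Data.Empty using (⊥-elim)
  open import Data.Sum using (_⊎_; inj₁; inj₂; [_,_]′)
  open import Relation.Nullary using (Dec; yes; no; ¬_)
  open import Relation.Binary.PropositionalEquality
  open FiniteSums

  ⟦_<_⟧ : ℤ → ℤ → ℕ
  ⟦ x < y ⟧ = indicator (x ℤP.<? y)

  when< : ℕ → ℕ → ℕ → ℕ
  when< a p z with a <? p
  ... | yes _ = z
  ... | no _  = 0

  unless< : ℕ → ℕ → ℕ → ℕ
  unless< a p z with a <? p
  ... | yes _ = 0
  ... | no _  = z

  module _ {a p : ℕ} (z : ℕ) where

    when<-yes : a < p → when< a p z ≡ z
    when<-yes a<p with a <? p
    ... | yes _   = refl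
    ... | no a≮p = ⊥-elim (a≮p a<p)

    when<-no : ¬ a < p → when< a p z ≡ 0
    when<-no a≮p with a <? p
    ... | yes a<p = ⊥-elim (a≮p a<p)
    ... | no _    = refl

    unless<-yes : a < p → unless< a p z ≡ 0
    unless<-yes a<p with a <? p
    ... | yes _   = refl
    ... | no a≮p = ⊥-elim (a≮p a<p)

    unless<-no : ¬ a < p → unless< a p z ≡ z
    unless<-no a≮p with a <? p
    ... | yes a<p = ⊥-elim (a≮p a<p)
    ... | no _    = refl

    when<-+-unless< : when< a p z + unless< a p z ≡ z
    when<-+-unless< with a <? p
    ... | yes _ = +-identityʳ z
    ... | no _  = refl

  when<-cong : ∀ {a p q} z → (a < p → a < q) → (a < q → a < p) → when< a p z ≡ when< a q z
  when<-cong {a} {p} {q} z to from with a <? p | a <? q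
  ... | yes _   | yes _   = refl
  ... | yes a<p | no a≮q = ⊥-elim (a≮q (to a<p))
  ... | no a≮p | yes a<q = ⊥-elim (a≮p (from a<q))
  ... | no _    | no _    = refl

  unless<-zero : ∀ a p → unless< a p 0 ≡ 0
  unless<-zero a p with a <? p
  ... | yes _ = refl
  ... | no _  = refl

  -- Going through Dec arguments, rather than `with`, lets proofs abstract over i ≟ j.
  swapBy : ∀ {P Q : Set} → Dec P → Dec Q → ℕ → ℕ → ℕ → ℕ
  swapBy (yes _) _       j k i = k
  swapBy (no _)  (yes _) j k i = j
  swapBy (no _)  (no _)  j k i = i

  swap : ℕ → ℕ → ℕ → ℕ
  swap j k i = swapBy (i ≟ j) (i ≟ k) j k i

  swap-left : ∀ j k → swap j k j ≡ k
  swap-left j k with j ≟ j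
  ... | yes _   = refl
  ... | no j≢j = ⊥-elim (j≢j refl)

  swap-right : ∀ {j k} → j ≢ k → swap j k k ≡ j
  swap-right {j} {k} j≢k with k ≟ j
  ... | yes k≡j = ⊥-elim (j≢k (sym k≡j))
  ... | no _ with k ≟ k
  ...   | yes _   = refl
  ...   | no k≢k = ⊥-elim (k≢k refl)

  swap-other : ∀ {j k i} → i ≢ j → i ≢ k → swap j k i ≡ i
  swap-other {j} {k} {i} i≢j i≢k with i ≟ j
  ... | yes i≡j = ⊥-elim (i≢j i≡j)
  ... | no _ with i ≟ k
  ...   | yes i≡k = ⊥-elim (i≢k i≡k)
  ...   | no _    = refl

  data SwapCase (j k i : ℕ) : Set where
    at-left   : i ≡ j → SwapCase j k i
    at-right  : i ≢ j → i ≡ k → SwapCase j k i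
    elsewhere : i ≢ j → i ≢ k → SwapCase j k i

  swap-cases : ∀ j k i → SwapCase j k i
  swap-cases j k i with i ≟ j
  ... | yes i≡j = at-left i≡j
  ... | no i≢j with i ≟ k
  ...   | yes i≡k = at-right i≢j i≡k
  ...   | no i≢k  = elsewhere i≢j i≢k

  module Window (l m r : ℕ) where

    j k len : ℕ
    j   = l
    k   = suc (j + m)
    len = l + suc (m + suc r)

    j<k : j < k
    j<k = s≤s (m≤m+n j m)

    k<len : k < len
    k<len = subst (suc k ≤_) (sym (shape l m r)) (m≤m+n (suc k) r)
      where shape : ∀ l m r → l + suc (m + suc r) ≡ suc (suc (l + m)) + r
            shape = solve-∀

    swap-before : ∀ {i} → i < j → swap j k i ≡ i
    swap-before i<j = swap-other (<⇒≢ i<j) (<⇒≢ (<-trans i<j j<k))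

    swap-between : ∀ {i} → j < i → i < k → swap j k i ≡ i
    swap-between j<i i<k = swap-other (≢-sym (<⇒≢ j<i)) (<⇒≢ i<k)

    swap-after : ∀ {i} → k < i → swap j k i ≡ i
    swap-after k<i = swap-other (≢-sym (<⇒≢ (<-trans j<k k<i))) (≢-sym (<⇒≢ k<i))

    swap-<len : ∀ {p} → p < len → swap j k p < len
    swap-<len {p} p<len with swap-cases j k p
    ... | at-left refl       = subst (_< len) (sym (swap-left j k)) k<len
    ... | at-right k≢j refl = subst (_< len) (sym (swap-right (≢-sym k≢j))) (<-trans j<k k<len)
    ... | elsewhere p≢j p≢k = subst (_< len) (sym (swap-other p≢j p≢k)) p<len

    ∑-by-pieces : ∀ f {A x B y C} → ∑ f 0 l ≡ A → f j ≡ x → ∑ f (suc j) m ≡ B → f k ≡ y → ∑ f (suc k) r ≡ C →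
                  ∑ f 0 len ≡ A + (x + (B + (y + C)))
    ∑-by-pieces f refl refl refl refl refl
      rewrite ∑-split f 0 l (suc (m + suc r)) | ∑-split f (suc j) m (suc r) = refl

    ∑-swap : ∀ f → ∑ (λ i → f (swap j k i)) 0 len ≡ ∑ f 0 len
    ∑-swap f = begin
      ∑ (λ i → f (swap j k i)) 0 len
        ≡⟨ ∑-by-pieces (λ i → f (swap j k i))
             (∑-cong 0 l λ i _ i<j → cong f (swap-before i<j))
             (cong f (swap-left j k))
             (∑-cong (suc j) m λ i j<i i<k → cong f (swap-between j<i i<k))
             (cong f (swap-right (<⇒≢ j<k)))
             (∑-cong (suc k) r λ i k<i _ → cong f (swap-after k<i)) ⟩
      A + (f k + (B + (f j + C)))  ≡⟨ exchange A (f k) B (f j) C ⟩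
      A + (f j + (B + (f k + C)))  ≡⟨ sym (∑-by-pieces f refl refl refl refl refl) ⟩
      ∑ f 0 len ∎
      where
      open ≡-Reasoning
      A B C : ℕ
      A = ∑ f 0 l
      B = ∑ f (suc j) m
      C = ∑ f (suc k) r
      exchange : ∀ A x B y C → A + (x + (B + (y + C))) ≡ A + (y + (B + (x + C)))
      exchange = solve-∀

    rowInversions : (ℕ → ℤ) → ℕ → ℕ
    rowInversions u x = ∑ (λ p → when< x p ⟦ u p < u x ⟧) 0 len

    inversions : (ℕ → ℤ) → ℕ
    inversions u = ∑ (rowInversions u) 0 len

    swapped : (ℕ → ℤ) → ℕ → ℤ
    swapped u p = u (swap j k p)

    module _ (u : ℕ → ℤ) (uk<uj : u k ℤ.< u j) (covered : ∀ q → j < q → q < k → u q ℤ.< u k) where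

      private
        u′ : ℕ → ℤ
        u′ = swapped u

      rowInversions-outside : ∀ x → x < j ⊎ k < x → rowInversions u′ x ≡ rowInversions u x
      rowInversions-outside x side = begin
        ∑ (λ p → when< x p ⟦ u′ p < u′ x ⟧) 0 len                 ≡⟨ ∑-cong′ 0 len reindex ⟩
        ∑ (λ p → when< x (swap j k p) ⟦ u′ p < u x ⟧) 0 len      ≡⟨ ∑-swap (λ q → when< x q ⟦ u q < u x ⟧) ⟩
        rowInversions u x ∎
        where
        open ≡-Reasoning
        x-fixed : swap j k x ≡ x
        x-fixed = [ swap-before , swap-after ]′ side
        same-side : ∀ z → when< x j z ≡ when< x k z
        same-side z = [ (λ x<j → when<-cong z (λ _ → <-trans x<j j<k) (λ _ → x<j))
                      , (λ k<x → when<-cong z (λ x<j → ⊥-elim (<-asym x<j (<-trans j<k k<x)))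
                                              (λ x<k → ⊥-elim (<-asym x<k k<x))) ]′ side
        reindex : ∀ p → when< x p ⟦ u′ p < u′ x ⟧ ≡ when< x (swap j k p) ⟦ u′ p < u x ⟧
        reindex p rewrite x-fixed with swap-cases j k p
        ... | at-left refl       rewrite swap-left j k = same-side _
        ... | at-right k≢j refl rewrite swap-right (≢-sym k≢j) = sym (same-side _)
        ... | elsewhere p≢j p≢k rewrite swap-other p≢j p≢k = refl

      rowInversions-between : ∀ x → j < x → x < k → rowInversions u′ x ≡ rowInversions u x
      rowInversions-between x j<x x<k rewrite swap-between j<x x<k = begin
        ∑ f′ 0 len                     ≡⟨ ∑-by-pieces f′
                                            (∑-cong 0 l λ i _ i<j → cong (λ q → g′ q i) (swap-before i<j))
                                            (when<-no _ (<⇒≯ j<x))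
                                            (∑-cong (suc j) m λ i j<i i<k → cong (λ q → g′ q i) (swap-between j<i i<k))
                                            (trans (cong (λ q → g′ q k) (swap-right (<⇒≢ j<k)))
                                                   (trans (when<-yes _ x<k) (indicator-no _ (ℤP.<-asym (ℤP.<-trans (covered x j<x x<k) uk<uj)))))
                                            (∑-cong (suc k) r λ i k<i _ → cong (λ q → g′ q i) (swap-after k<i)) ⟩
        A + (0 + (B + (0 + C)))        ≡⟨ sym (∑-by-pieces f refl (when<-no _ (<⇒≯ j<x)) refl
                                            (trans (when<-yes _ x<k) (indicator-no _ (ℤP.<-asym (covered x j<x x<k))))
                                            refl) ⟩
        ∑ f 0 len ∎
        where
        open ≡-Reasoning
        g′ : ℕ → ℕ → ℕ
        g′ q p = when< x p ⟦ u q < u x ⟧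
        f′ f : ℕ → ℕ
        f′ p = g′ (swap j k p) p
        f  p = g′ p p
        A B C : ℕ
        A = ∑ f 0 l
        B = ∑ f (suc j) m
        C = ∑ f (suc k) r

      rowInversions′-at-j : rowInversions u′ j ≡ m + rowInversions u k
      rowInversions′-at-j rewrite swap-left j k = trans
        (∑-by-pieces (λ p → when< j p ⟦ u′ p < u k ⟧)
          (∑-zero _ 0 l λ i _ i<j → when<-no _ (<⇒≯ i<j))
          (when<-no _ (n≮n j))
          (trans (∑-cong (suc j) m λ i j<i i<k →
                    trans (when<-yes _ j<i)
                          (trans (cong (λ q → ⟦ u q < u k ⟧) (swap-between j<i i<k))
                                 (indicator-yes _ (covered i j<i i<k))))
                 (∑-one (suc j) m))
          (trans (when<-yes _ j<k)
                 (trans (cong (λ q → ⟦ u q < u k ⟧) (swap-right (<⇒≢ j<k))) (indicator-no _ (ℤP.<-asym uk<uj))))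
          (∑-cong (suc k) r λ i k<i _ →
             trans (when<-yes _ (<-trans j<k k<i))
                   (trans (cong (λ q → ⟦ u q < u k ⟧) (swap-after k<i)) (sym (when<-yes _ k<i)))))
        (cong (λ z → m + z) (sym (∑-by-pieces (λ p → when< k p ⟦ u p < u k ⟧)
          (∑-zero _ 0 l λ i _ i<j → when<-no _ (<⇒≯ (<-trans i<j j<k)))
          (when<-no _ (<⇒≯ j<k))
          (∑-zero _ (suc j) m λ i _ i<k → when<-no _ (<⇒≯ i<k))
          (when<-no _ (n≮n k))
          refl)))

      rowInversions-at-j : rowInversions u j ≡ suc m + rowInversions u′ k
      rowInversions-at-j = trans
        (∑-by-pieces (λ p → when< j p ⟦ u p < u j ⟧)
          (∑-zero _ 0 l λ i _ i<j → when<-no _ (<⇒≯ i<j))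
          (when<-no _ (n≮n j))
          (trans (∑-cong (suc j) m λ i j<i i<k →
                    trans (when<-yes _ j<i) (indicator-yes _ (ℤP.<-trans (covered i j<i i<k) uk<uj)))
                 (∑-one (suc j) m))
          (trans (when<-yes _ j<k) (indicator-yes _ uk<uj))
          refl)
        (trans (+-suc m _) (cong (λ z → suc m + z) (sym (∑-by-pieces (λ p → when< k p ⟦ u′ p < u′ k ⟧)
          (∑-zero _ 0 l λ i _ i<j → when<-no _ (<⇒≯ (<-trans i<j j<k)))
          (when<-no _ (<⇒≯ j<k))
          (∑-zero _ (suc j) m λ i _ i<k → when<-no _ (<⇒≯ i<k))
          (when<-no _ (n≮n k))
          (∑-cong (suc k) r λ i k<i _ →
             trans (when<-yes _ k<i)
                   (trans (cong₂ (λ q q′ → ⟦ u q < u q′ ⟧) (swap-after k<i) (swap-right (<⇒≢ j<k)))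
                          (sym (when<-yes _ (<-trans j<k k<i)))))))))

      inversions-swap : inversions u′ + 1 ≡ inversions u
      inversions-swap = begin
        inversions u′ + 1
          ≡⟨ cong (_+ 1) (∑-by-pieces (rowInversions u′)
               (∑-cong 0 l λ x _ x<j → rowInversions-outside x (inj₁ x<j))
               rowInversions′-at-j
               (∑-cong (suc j) m λ x j<x x<k → rowInversions-between x j<x x<k)
               refl
               (∑-cong (suc k) r λ x k<x _ → rowInversions-outside x (inj₂ k<x))) ⟩
        A + (m + R k + (B + (R′ k + C))) + 1  ≡⟨ rearrange A m (R k) B (R′ k) C ⟩
        A + (suc m + R′ k + (B + (R k + C)))  ≡⟨ sym (∑-by-pieces R refl rowInversions-at-j refl refl refl) ⟩
        inversions u ∎
        where
        open ≡-Reasoning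
        R R′ : ℕ → ℕ
        R  = rowInversions u
        R′ = rowInversions u′
        A B C : ℕ
        A = ∑ R 0 l
        B = ∑ R (suc j) m
        C = ∑ R (suc k) r
        rearrange : ∀ A m x B y C → A + (m + x + (B + (y + C))) + 1 ≡ A + (suc m + y + (B + (x + C)))
        rearrange = solve-∀


module PeriodicCounts where

  open import Data.Nat as ℕ using (ℕ; suc; _+_; _*_; _<_)
  open import Data.Nat.Properties
  open import Data.Nat.Tactic.RingSolver using (solve-∀)
  open import Data.Integer as ℤ using (ℤ; +_)
  open import Data.Product using (_,_)
  import Data.Integer.Properties as ℤP
  open import Relation.Nullary using (¬_)
  open import Relation.Binary.PropositionalEquality
  open FiniteSums
  open WindowInversions

  -- With u extended to ℕ by u (p + c * n) = u p + c * n, periodicRow M a counts the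
  -- i ∈ [1, M * n] with u (a + i) < u a: the later copy-c hits plus the earlier copy-(c+1) hits.
  module Copies (n : ℕ) (u : ℕ → ℤ) where

    laterHits earlierHits allHits : ℕ → ℕ → ℕ
    laterHits   a c = ∑ (λ p → when<   a p ⟦ u p ℤ.+ + (c * n) < u a ⟧) 0 n
    earlierHits a c = ∑ (λ p → unless< a p ⟦ u p ℤ.+ + (c * n) < u a ⟧) 0 n
    allHits     a c = ∑ (λ p → ⟦ u p ℤ.+ + (c * n) < u a ⟧) 0 n

    periodicRow : ℕ → ℕ → ℕ
    periodicRow M a = ∑ (λ c → laterHits a c + earlierHits a (suc c)) 0 M

    periodicTotal : ℕ → ℕ
    periodicTotal M = ∑ (periodicRow M) 0 n

    laterHits-+-earlierHits : ∀ a c → laterHits a c + earlierHits a c ≡ allHits a c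
    laterHits-+-earlierHits a c =
      trans (sym (∑-distrib-+ _ _ 0 n)) (∑-cong′ 0 n (λ p → when<-+-unless< {a} {p} _))

    periodicRow-split : ∀ M′ a →
      periodicRow (suc M′) a ≡ laterHits a 0 + ∑ (allHits a) 1 M′ + earlierHits a (suc M′)
    periodicRow-split M′ a = begin
      periodicRow (suc M′) a
        ≡⟨ ∑-stagger (laterHits a) (earlierHits a) 0 M′ ⟩
      laterHits a 0 + ∑ (λ c → laterHits a c + earlierHits a c) 1 M′ + earlierHits a (suc M′)
        ≡⟨ cong (λ z → laterHits a 0 + z + earlierHits a (suc M′)) (∑-cong′ 1 M′ (laterHits-+-earlierHits a)) ⟩
      laterHits a 0 + ∑ (allHits a) 1 M′ + earlierHits a (suc M′) ∎
      where open ≡-Reasoning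

    periodicTotal-split : ∀ M′ → periodicTotal (suc M′) ≡
      ∑ (λ a → laterHits a 0) 0 n + ∑ (λ a → ∑ (allHits a) 1 M′) 0 n + ∑ (λ a → earlierHits a (suc M′)) 0 n
    periodicTotal-split M′ = begin
      periodicTotal (suc M′)
        ≡⟨ ∑-cong′ 0 n (periodicRow-split M′) ⟩
      ∑ (λ a → laterHits a 0 + ∑ (allHits a) 1 M′ + earlierHits a (suc M′)) 0 n
        ≡⟨ ∑-distrib-+ _ _ 0 n ⟩
      ∑ (λ a → laterHits a 0 + ∑ (allHits a) 1 M′) 0 n + ∑ (λ a → earlierHits a (suc M′)) 0 n
        ≡⟨ cong (_+ ∑ (λ a → earlierHits a (suc M′)) 0 n) (∑-distrib-+ _ _ 0 n) ⟩
      ∑ (λ a → laterHits a 0) 0 n + ∑ (λ a → ∑ (allHits a) 1 M′) 0 n + ∑ (λ a → earlierHits a (suc M′)) 0 n ∎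
      where open ≡-Reasoning

    earlierHits-vanish : ∀ M → (∀ a p → a < n → p < n → ¬ (u p ℤ.+ + (M * n) ℤ.< u a)) →
                         ∑ (λ a → earlierHits a M) 0 n ≡ 0
    earlierHits-vanish M separated =
      ∑-zero _ 0 n λ a _ a<n → ∑-zero _ 0 n λ p _ p<n →
        trans (cong (unless< a p) (indicator-no _ (separated a p a<n p<n))) (unless<-zero a p)

  module _ (l m r M′ : ℕ) (u : ℕ → ℤ) where
    open Window l m r
    open Copies len using (laterHits; allHits; periodicTotal; periodicTotal-split; earlierHits-vanish)

    private
      u′ : ℕ → ℤ
      u′ = swapped u

    laterHits-zero : ∀ v a → laterHits v a 0 ≡ rowInversions v a
    laterHits-zero v a = ∑-cong′ 0 len (λ p → cong (λ z → when< a p ⟦ z < v a ⟧) (ℤP.+-identityʳ (v p)))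

    allHits-swap : ∑ (λ a → ∑ (allHits u′ a) 1 M′) 0 len ≡ ∑ (λ a → ∑ (allHits u a) 1 M′) 0 len
    allHits-swap = trans
      (∑-cong′ 0 len λ a → ∑-cong′ 1 M′ λ c → ∑-swap (λ p → ⟦ u p ℤ.+ + (c * len) < u′ a ⟧))
      (∑-swap (λ a → ∑ (allHits u a) 1 M′))

    periodicTotal-swap : u k ℤ.< u j → (∀ q → j < q → q < k → u q ℤ.< u k) →
      (∀ a p → a < len → p < len → ¬ (u p ℤ.+ + (suc M′ * len) ℤ.< u a)) →
      periodicTotal u′ (suc M′) + 1 ≡ periodicTotal u (suc M′)
    periodicTotal-swap uk<uj covered separated = begin
      periodicTotal u′ (suc M′) + 1
        ≡⟨ cong (_+ 1) (periodicTotal-split u′ M′) ⟩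
      X′ + Y′ + Z′ + 1
        ≡⟨ cong₂ (λ y z → X′ + y + z + 1) allHits-swap
             (earlierHits-vanish u′ (suc M′) λ a p a<len p<len →
                separated (swap j k a) (swap j k p) (swap-<len a<len) (swap-<len p<len)) ⟩
      X′ + Y + 0 + 1
        ≡⟨ rearrange X′ Y ⟩
      X′ + 1 + Y
        ≡⟨ cong (λ x → x + 1 + Y) (∑-cong′ 0 len (laterHits-zero u′)) ⟩
      inversions u′ + 1 + Y
        ≡⟨ cong (_+ Y) (inversions-swap u uk<uj covered) ⟩
      inversions u + Y
        ≡⟨ cong (_+ Y) (sym (∑-cong′ 0 len (laterHits-zero u))) ⟩
      X + Y
        ≡⟨ trans (sym (+-identityʳ (X + Y))) (cong (λ z → X + Y + z) (sym (earlierHits-vanish u (suc M′) separated))) ⟩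
      X + Y + Z
        ≡⟨ sym (periodicTotal-split u M′) ⟩
      periodicTotal u (suc M′) ∎
      where
      open ≡-Reasoning
      X′ Y′ Z′ X Y Z : ℕ
      X′ = ∑ (λ a → laterHits u′ a 0) 0 len
      Y′ = ∑ (λ a → ∑ (allHits u′ a) 1 M′) 0 len
      Z′ = ∑ (λ a → Copies.earlierHits len u′ a (suc M′)) 0 len
      X  = ∑ (λ a → laterHits u a 0) 0 len
      Y  = ∑ (λ a → ∑ (allHits u a) 1 M′) 0 len
      Z  = ∑ (λ a → Copies.earlierHits len u a (suc M′)) 0 len
      rearrange : ∀ x y → x + y + 0 + 1 ≡ x + 1 + y
      rearrange = solve-∀

  periodicTotal-transposition : ∀ {n jj kk} M′ (u : ℕ → ℤ) → jj < kk → kk < n →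
    u kk ℤ.< u jj → (∀ q → jj < q → q < kk → u q ℤ.< u kk) →
    (∀ a p → a < n → p < n → ¬ (u p ℤ.+ + (suc M′ * n) ℤ.< u a)) →
    Copies.periodicTotal n (λ p → u (swap jj kk p)) (suc M′) + 1 ≡ Copies.periodicTotal n u (suc M′)
  periodicTotal-transposition {n} {jj} M′ u jj<kk kk<n with m≤n⇒∃[o]m+o≡n jj<kk | m≤n⇒∃[o]m+o≡n kk<n
  ... | m , refl | r , n≡ = reshape (trans (shape jj m r) n≡)
    where
    shape : ∀ l m r → l + suc (m + suc r) ≡ suc (suc l + m) + r
    shape = solve-∀
    reshape : ∀ {n} → Window.len jj m r ≡ n →
      u (suc jj + m) ℤ.< u jj → (∀ q → jj < q → q < suc jj + m → u q ℤ.< u (suc jj + m)) →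
      (∀ a p → a < n → p < n → ¬ (u p ℤ.+ + (suc M′ * n) ℤ.< u a)) →
      Copies.periodicTotal n (λ p → u (swap jj (suc jj + m) p)) (suc M′) + 1 ≡ Copies.periodicTotal n u (suc M′)
    reshape refl = periodicTotal-swap jj m r M′ u

  periodicTotal-cong : ∀ n M {u u′ : ℕ → ℤ} → (∀ p → p < n → u p ≡ u′ p) →
                       Copies.periodicTotal n u M ≡ Copies.periodicTotal n u′ M
  periodicTotal-cong n M {u} {u′} eq = ∑-cong 0 n λ a _ a<n → ∑-cong′ 0 M λ c → cong₂ _+_
    (∑-cong 0 n λ p _ p<n → cong₂ (λ x y → when< a p ⟦ x ℤ.+ + (c * n) < y ⟧) (eq p p<n) (eq a a<n))
    (∑-cong 0 n λ p _ p<n → cong₂ (λ x y → unless< a p ⟦ x ℤ.+ + (suc c * n) < y ⟧) (eq p p<n) (eq a a<n))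


module IntegerOffsets where

  open import Data.Nat as ℕ using (ℕ; suc)
  open import Data.Integer as ℤ using (ℤ; +_; _+_; _-_; -_; _≤_; _<_)
  import Data.Integer.Properties as ℤP
  open import Data.Integer.Tactic.RingSolver using (solve-∀)
  open import Data.Product using (Σ-syntax; _,_)
  open import Relation.Binary.PropositionalEquality

  +-cancelˡ-≡ : ∀ x {a b} → x + a ≡ x + b → a ≡ b
  +-cancelˡ-≡ x {a} {b} eq = trans (sub x a) (trans (cong (_- x) eq) (sym (sub x b)))
    where sub : ∀ x a → a ≡ x + a - x
          sub = solve-∀

  +ℕ-injectiveʳ : ∀ x {a b} → x + + a ≡ x + + b → a ≡ b
  +ℕ-injectiveʳ x eq = ℤP.+-injective (+-cancelˡ-≡ x eq)

  +ℕ-assoc : ∀ x a b → x + + a + + b ≡ x + + (a ℕ.+ b)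
  +ℕ-assoc x a b = trans (ℤP.+-assoc x (+ a) (+ b)) (cong (λ e → x + e) (sym (ℤP.pos-+ a b)))

  +ℕ-mono-< : ∀ x {a b} → a ℕ.< b → x + + a < x + + b
  +ℕ-mono-< x a<b = ℤP.+-monoʳ-< x (ℤ.+<+ a<b)

  +ℕ-mono-≤ : ∀ x {a b} → a ℕ.≤ b → x + + a ≤ x + + b
  +ℕ-mono-≤ x a≤b = ℤP.+-monoʳ-≤ x (ℤ.+≤+ a≤b)

  +ℕ-cancel-< : ∀ x {a b} → x + + a < x + + b → a ℕ.< b
  +ℕ-cancel-< x {a} {b} lt = ℤP.drop‿+<+ (subst₂ _<_ (cancel x (+ a)) (cancel x (+ b)) (ℤP.+-monoʳ-< (- x) lt))
    where cancel : ∀ x a → - x + (x + a) ≡ a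
          cancel = solve-∀

  +ℕ-cancel-≤ : ∀ x {a b} → x + + a ≤ x + + b → a ℕ.≤ b
  +ℕ-cancel-≤ x {a} {b} le = ℤP.drop‿+≤+ (subst₂ _≤_ (cancel x (+ a)) (cancel x (+ b)) (ℤP.+-monoʳ-≤ (- x) le))
    where cancel : ∀ x a → - x + (x + a) ≡ a
          cancel = solve-∀

  <+ℕsuc : ∀ x d → x < x + + suc d
  <+ℕsuc x d = subst (_< x + + suc d) (ℤP.+-identityʳ x) (+ℕ-mono-< x (ℕ.s≤s ℕ.z≤n))

  ≤⇒≡+ : ∀ {x y} → x ≤ y → Σ[ d ∈ ℕ ] y ≡ x + + d
  ≤⇒≡+ {x} {y} x≤y with y - x in eq | ℤP.i≤j⇒0≤j-i x≤y
  ... | + d | _ = d , trans (split y x) (cong (λ e → x + e) eq)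
    where split : ∀ y x → y ≡ x + (y - x)
          split = solve-∀

  <⇒≡+suc : ∀ {x y} → x < y → Σ[ d ∈ ℕ ] y ≡ x + + suc d
  <⇒≡+suc {x} x<y with ≤⇒≡+ (ℤP.i<j⇒suc[i]≤j x<y)
  ... | d , eq = d , trans eq (trans (shift x (+ d)) (cong (λ e → x + e) (sym (ℤP.pos-+ 1 d))))
    where shift : ∀ x d → (ℤ.1ℤ + x) + d ≡ x + (ℤ.1ℤ + d)
          shift = solve-∀

  ≡+⇒≤ : ∀ {x y} d → y ≡ x + + d → x ≤ y
  ≡+⇒≤ {x} d refl = ℤP.i≤i+j x (+ d)


module InversionLists where

  open import Data.Nat as ℕ using (ℕ; zero; suc; s≤s; z≤n)
  import Data.Nat.Properties as ℕP
  open import Data.Integer as ℤ using (ℤ; +_; _+_; _≤_; _<_)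
  import Data.Integer.Properties as ℤP
  open import Data.Empty using (⊥-elim)
  open import Data.Sum using (inj₁; inj₂)
  open import Data.Product using (Σ-syntax; _,_; _×_; proj₁; proj₂)
  open import Data.List using (List; []; _∷_; _++_; length)
  open import Data.List.Properties using (length-++)
  open import Data.List.Membership.Propositional using (_∈_)
  open import Data.List.Membership.Propositional.Properties using (∈-++⁻; ∈-++⁺ˡ; ∈-++⁺ʳ)
  open import Data.List.Relation.Unary.Any using (here; there)
  open import Data.List.Relation.Unary.All as All using (All)
  open import Data.List.Relation.Unary.Unique.Propositional using (Unique)
  import Data.List.Relation.Unary.Unique.Propositional.Properties as Unique
  open import Data.List.Relation.Unary.AllPairs using (_∷_; [])
  open import Function using (mk⇔)
  open import Relation.Nullary using (Dec; yes; no; ¬_)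
  open import Relation.Binary.PropositionalEquality
  open import Defs using (Inv; HasLength)
  open FiniteSums
  open WindowInversions using (⟦_<_⟧)
  open IntegerOffsets

  consIf : ∀ {P A : Set} → Dec P → A → List A → List A
  consIf (yes _) x xs = x ∷ xs
  consIf (no _)  x xs = xs

  module InversionList (n N : ℕ) (h : ℤ → ℤ) where

    inversionsAt : ℤ → ℕ
    inversionsAt x = ∑ (λ i → ⟦ h (x + + i) < h x ⟧) 1 N

    row : ℤ → ℕ → ℕ → List (ℤ × ℤ)
    row x i zero    = []
    row x i (suc m) = consIf (h (x + + i) ℤP.<? h x) (x , x + + i) (row x (suc i) m)

    InRow : ℤ → ℕ → ℕ → ℤ × ℤ → Set
    InRow x i m p = Σ[ i′ ∈ ℕ ] (i ℕ.≤ i′ × i′ ℕ.< i ℕ.+ m × p ≡ (x , x + + i′) × h (x + + i′) < h x)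

    length-row : ∀ x i m → length (row x i m) ≡ ∑ (λ i → ⟦ h (x + + i) < h x ⟧) i m
    length-row x i zero = refl
    length-row x i (suc m) with h (x + + i) ℤP.<? h x
    ... | yes _ = cong suc (length-row x (suc i) m)
    ... | no _  = length-row x (suc i) m

    InRow-suc : ∀ {x i m p} → InRow x (suc i) m p → InRow x i (suc m) p
    InRow-suc {i = i} {m} (i′ , i<i′ , i′<end , eq , lt) = i′ , ℕP.<⇒≤ i<i′ , subst (i′ ℕ.<_) (sym (ℕP.+-suc i m)) i′<end , eq , lt

    ∈-row⁻ : ∀ x i m {p} → p ∈ row x i m → InRow x i m p
    ∈-row⁻ x i (suc m) p∈ with h (x + + i) ℤP.<? h x | p∈
    ... | yes lt | here refl = i , ℕP.≤-refl , ℕP.m<m+n i (s≤s z≤n) , refl , lt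
    ... | yes _  | there p∈′ = InRow-suc (∈-row⁻ x (suc i) m p∈′)
    ... | no _   | p∈′       = InRow-suc (∈-row⁻ x (suc i) m p∈′)

    ∈-row⁺ : ∀ x i m i′ → i ℕ.≤ i′ → i′ ℕ.< i ℕ.+ m → h (x + + i′) < h x → (x , x + + i′) ∈ row x i m
    ∈-row⁺ x i zero i′ i≤i′ i′<i _ = ⊥-elim (ℕP.<⇒≱ i′<i (subst (ℕ._≤ i′) (sym (ℕP.+-identityʳ i)) i≤i′))
    ∈-row⁺ x i (suc m) i′ i≤i′ i′<end lt with i ℕP.≟ i′ | h (x + + i) ℤP.<? h x
    ... | yes refl | yes _  = here refl
    ... | yes refl | no ≮   = ⊥-elim (≮ lt)
    ... | no i≢i′  | yes _  = there (∈-row⁺ x (suc i) m i′ (ℕP.≤∧≢⇒< i≤i′ i≢i′) (subst (i′ ℕ.<_) (ℕP.+-suc i m) i′<end) lt)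
    ... | no i≢i′  | no _   = ∈-row⁺ x (suc i) m i′ (ℕP.≤∧≢⇒< i≤i′ i≢i′) (subst (i′ ℕ.<_) (ℕP.+-suc i m) i′<end) lt

    unique-row : ∀ x i m → Unique (row x i m)
    unique-row x i zero = []
    unique-row x i (suc m) with h (x + + i) ℤP.<? h x
    ... | yes _ = All.tabulate (λ p∈ eq → fresh p∈ eq) ∷ unique-row x (suc i) m
      where
      fresh : ∀ {p} → p ∈ row x (suc i) m → (x , x + + i) ≢ p
      fresh p∈ eq with ∈-row⁻ x (suc i) m p∈
      ... | i′ , i<i′ , _ , refl , _ = ℕP.<⇒≢ i<i′ (+ℕ-injectiveʳ x (cong proj₂ eq))
    ... | no _ = unique-row x (suc i) m

    rows : ℕ → ℕ → List (ℤ × ℤ)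
    rows k zero    = []
    rows k (suc m) = row (+ k) 1 N ++ rows (suc k) m

    length-rows : ∀ k m → length (rows k m) ≡ ∑ (λ k → inversionsAt (+ k)) k m
    length-rows k zero    = refl
    length-rows k (suc m) = trans (length-++ (row (+ k) 1 N)) (cong₂ ℕ._+_ (length-row (+ k) 1 N) (length-rows (suc k) m))

    ∈-rows⁻ : ∀ k m {p} → p ∈ rows k m → Σ[ k′ ∈ ℕ ] (k ℕ.≤ k′ × k′ ℕ.< k ℕ.+ m × p ∈ row (+ k′) 1 N)
    ∈-rows⁻ k (suc m) p∈ with ∈-++⁻ (row (+ k) 1 N) p∈
    ... | inj₁ p∈row  = k , ℕP.≤-refl , ℕP.m<m+n k (s≤s z≤n) , p∈row
    ... | inj₂ p∈rows with ∈-rows⁻ (suc k) m p∈rows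
    ...   | k′ , k<k′ , k′<end , p∈row = k′ , ℕP.<⇒≤ k<k′ , subst (k′ ℕ.<_) (sym (ℕP.+-suc k m)) k′<end , p∈row

    ∈-rows⁺ : ∀ k m k′ {p} → k ℕ.≤ k′ → k′ ℕ.< k ℕ.+ m → p ∈ row (+ k′) 1 N → p ∈ rows k m
    ∈-rows⁺ k zero k′ k≤k′ k′<k _ = ⊥-elim (ℕP.<⇒≱ k′<k (subst (ℕ._≤ k′) (sym (ℕP.+-identityʳ k)) k≤k′))
    ∈-rows⁺ k (suc m) k′ k≤k′ k′<end p∈ with k ℕP.≟ k′
    ... | yes refl = ∈-++⁺ˡ p∈
    ... | no k≢k′  = ∈-++⁺ʳ (row (+ k) 1 N)
                       (∈-rows⁺ (suc k) m k′ (ℕP.≤∧≢⇒< k≤k′ k≢k′) (subst (k′ ℕ.<_) (ℕP.+-suc k m) k′<end) p∈)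

    unique-rows : ∀ k m → Unique (rows k m)
    unique-rows k zero    = []
    unique-rows k (suc m) = Unique.++⁺ (unique-row (+ k) 1 N) (unique-rows (suc k) m) disjoint
      where
      disjoint : ∀ {p} → ¬ (p ∈ row (+ k) 1 N × p ∈ rows (suc k) m)
      disjoint (p∈row , p∈rows) with ∈-row⁻ (+ k) 1 N p∈row | ∈-rows⁻ (suc k) m p∈rows
      ... | _ , _ , _ , refl , _ | k′ , k<k′ , _ , p∈row′ with ∈-row⁻ (+ k′) 1 N p∈row′
      ... | _ , _ , _ , eq , _ = ℕP.<⇒≢ k<k′ (ℤP.+-injective (cong proj₁ eq))

    hasLength : (∀ x y → x < y → h y < h x → y ≤ x + + N) → HasLength n h (∑ (λ k → inversionsAt (+ k)) 1 n)
    hasLength bounded = rows 1 n , unique-rows 1 n , length-rows 1 n , λ p → mk⇔ (sound p) (complete p)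
      where
      sound : ∀ p → p ∈ rows 1 n → Inv n h p
      sound p p∈ with ∈-rows⁻ 1 n p∈
      ... | k′ , 1≤k′ , k′<end , p∈row with ∈-row⁻ (+ k′) 1 N p∈row
      ... | suc i′ , _ , _ , refl , lt = ℤ.+≤+ 1≤k′ , ℤ.+≤+ (ℕP.≤-pred k′<end) , <+ℕsuc (+ k′) i′ , lt
      complete : ∀ p → Inv n h p → p ∈ rows 1 n
      complete (x , y) (1≤x , x≤n , x<y , hy<hx) with ≤⇒≡+ 1≤x | <⇒≡+suc x<y
      ... | d , refl | i′ , refl =
        ∈-rows⁺ 1 n (suc d) (s≤s z≤n) (s≤s (ℤP.drop‿+≤+ x≤n))
          (∈-row⁺ (+ suc d) 1 N (suc i′) (s≤s z≤n) (s≤s (+ℕ-cancel-≤ (+ suc d) (bounded _ _ x<y hy<hx))) hy<hx)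


module PeriodicDisplacement where

  open import Data.Nat as ℕ using (ℕ; zero; suc; s≤s; z≤n; NonZero)
  open import Data.Integer as ℤ using (ℤ; +_; -[1+_]; _+_; _-_; _*_; -_; ∣_∣; _≤_; _<_; _%ℕ_; _/ℕ_)
  import Data.Integer.Properties as ℤP
  open import Data.Integer.DivMod using (a≡a%ℕn+[a/ℕn]*n; n%ℕd<d)
  open import Data.Integer.Tactic.RingSolver using (solve-∀)
  open import Data.Product using (Σ-syntax; _,_; _×_; proj₁; proj₂)
  open import Relation.Binary.PropositionalEquality
  open FiniteSums using (∑; term≤∑)
  open IntegerOffsets using (+ℕ-assoc)

  ∣∣≤⇒-≤∧≤ : ∀ z G → ∣ z ∣ ℕ.≤ G → - + G ≤ z × z ≤ + G
  ∣∣≤⇒-≤∧≤ (+ m)    G       m≤G       = ℤP.≤-trans (ℤP.neg-mono-≤ (ℤ.+≤+ z≤n)) (ℤ.+≤+ z≤n) , ℤ.+≤+ m≤G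
  ∣∣≤⇒-≤∧≤ -[1+ m ] (suc G) (s≤s m≤G) = ℤ.-≤- m≤G , ℤ.-≤+

  module Periodic (n : ℕ) (w : ℤ → ℤ) (periodic : ∀ i → w (i + + n) ≡ w i + + n) where

    periodic-ℕ : ∀ x c → w (x + + (c ℕ.* n)) ≡ w x + + (c ℕ.* n)
    periodic-ℕ x zero    = trans (cong w (ℤP.+-identityʳ x)) (sym (ℤP.+-identityʳ (w x)))
    periodic-ℕ x (suc c) = begin
      w (x + + (n ℕ.+ c ℕ.* n))    ≡⟨ cong w (trans (cong (λ z → x + z) (ℤP.pos-+ n (c ℕ.* n))) (sym (ℤP.+-assoc x _ _))) ⟩
      w (x + + n + + (c ℕ.* n))    ≡⟨ periodic-ℕ (x + + n) c ⟩
      w (x + + n) + + (c ℕ.* n)    ≡⟨ cong (_+ + (c ℕ.* n)) (periodic x) ⟩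
      w x + + n + + (c ℕ.* n)      ≡⟨ trans (ℤP.+-assoc (w x) _ _) (cong (λ z → w x + z) (sym (ℤP.pos-+ n (c ℕ.* n)))) ⟩
      w x + + (n ℕ.+ c ℕ.* n)      ∎
      where open ≡-Reasoning

    displacement : ℤ → ℤ
    displacement x = w x - x

    displacement-periodic : ∀ x c → displacement (x + + (c ℕ.* n)) ≡ displacement x
    displacement-periodic x c rewrite periodic-ℕ x c = cancel (w x) x (+ (c ℕ.* n))
      where cancel : ∀ a b c → a + c - (b + c) ≡ a - b
            cancel = solve-∀

    maxDisplacement : ℕ
    maxDisplacement = ∑ (λ i → ∣ displacement (+ i) ∣) 0 n

    displacement-bounded : .{{_ : NonZero n}} →
      ∀ x → - + maxDisplacement ≤ displacement x × displacement x ≤ + maxDisplacement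
    displacement-bounded x = subst (λ d → - + maxDisplacement ≤ d × d ≤ + maxDisplacement) residue
      (∣∣≤⇒-≤∧≤ _ maxDisplacement (term≤∑ (λ i → ∣ displacement (+ i) ∣) 0 n (x %ℕ n) z≤n (n%ℕd<d x n)))
      where
      residue : displacement (+ (x %ℕ n)) ≡ displacement x
      residue with x /ℕ n | a≡a%ℕn+[a/ℕn]*n x n
      ... | + K      | x≡ = sym (trans (cong displacement (trans x≡ (cong (λ z → + (x %ℕ n) + z) (sym (ℤP.pos-* K n)))))
                                       (displacement-periodic (+ (x %ℕ n)) K))
      ... | -[1+ K ] | x≡ = trans (cong displacement (move (+ (x %ℕ n)) x (+ (suc K ℕ.* n)) x≡′))
                                  (displacement-periodic x (suc K))
        where
        x≡′ : x ≡ + (x %ℕ n) - + (suc K ℕ.* n)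
        x≡′ = trans x≡ (cong (λ q → + (x %ℕ n) + q)
                (trans (sym (ℤP.neg-distribˡ-* (+ suc K) (+ n))) (cong -_ (sym (ℤP.pos-* (suc K) n)))))
        move : ∀ r x d → x ≡ r - d → r ≡ x + d
        move r x d refl = sym (cancel r d)
          where cancel : ∀ r d → r - d + d ≡ r
                cancel = solve-∀

    inversion-span : .{{_ : NonZero n}} → ∀ x y → w y < w x → y ≤ x + + (maxDisplacement ℕ.+ maxDisplacement)
    inversion-span x y wy<wx = ℤP.<⇒≤ (begin-strict
      y                          ≡⟨ solve₁ y (+ G) ⟩
      y + - + G + + G            ≤⟨ ℤP.+-monoˡ-≤ (+ G) (ℤP.+-monoʳ-≤ y (proj₁ (displacement-bounded y))) ⟩
      y + displacement y + + G   ≡⟨ cong (_+ + G) (solve₂ (w y) y) ⟩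
      w y + + G                  <⟨ ℤP.+-monoˡ-< (+ G) wy<wx ⟩
      w x + + G                  ≡⟨ cong (_+ + G) (sym (solve₂ (w x) x)) ⟩
      x + displacement x + + G   ≤⟨ ℤP.+-monoˡ-≤ (+ G) (ℤP.+-monoʳ-≤ x (proj₂ (displacement-bounded x))) ⟩
      x + + G + + G              ≡⟨ +ℕ-assoc x G G ⟩
      x + + (G ℕ.+ G)            ∎)
      where
      open ℤP.≤-Reasoning
      G : ℕ
      G = maxDisplacement
      solve₁ : ∀ a b → a ≡ a + - b + b
      solve₁ = solve-∀
      solve₂ : ∀ a b → b + (a - b) ≡ a
      solve₂ = solve-∀


module Transpositions where

  open import Data.Nat as ℕ using (ℕ; zero; suc; NonZero)
  import Data.Nat.Properties as ℕP
  open import Data.Integer as ℤ using (ℤ; +_; -[1+_]; _+_; _-_; _*_; -_; _≤_; _<_; _%ℕ_; _/ℕ_)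
  import Data.Integer.Properties as ℤP
  open import Data.Integer.DivMod using (a≡a%ℕn+[a/ℕn]*n; n%ℕd<d)
  open import Data.Integer.Tactic.RingSolver using (solve-∀)
  open import Data.Bool using (true; false; T)
  open import Data.Empty using (⊥-elim)
  open import Data.Sum using (inj₁; inj₂)
  open import Data.Product using (Σ-syntax; _,_; _×_; proj₁; proj₂)
  open import Relation.Nullary using (yes; no; ¬_)
  open import Relation.Binary.PropositionalEquality
  open import Defs using (t; _≡[_]_)
  open WindowInversions using (swap; swap-left; swap-right; swap-other; swap-cases; at-left; at-right; elsewhere)
  open IntegerOffsets using (≡+⇒≤)

  module _ (n : ℕ) .{{_ : NonZero n}} (j k x : ℤ) where

    t-at-j : x %ℕ n ≡ j %ℕ n → t n j k x ≡ x + (k - j)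
    t-at-j x≡j with x %ℕ n ℕ.≡ᵇ j %ℕ n in eq
    ... | true  = refl
    ... | false = ⊥-elim (subst T eq (ℕP.≡⇒≡ᵇ _ _ x≡j))

    t-at-k : x %ℕ n ≢ j %ℕ n → x %ℕ n ≡ k %ℕ n → t n j k x ≡ x - (k - j)
    t-at-k x≢j x≡k with x %ℕ n ℕ.≡ᵇ j %ℕ n in eq
    ... | true  = ⊥-elim (x≢j (ℕP.≡ᵇ⇒≡ _ _ (subst T (sym eq) _)))
    ... | false with x %ℕ n ℕ.≡ᵇ k %ℕ n in eq′
    ...   | true  = refl
    ...   | false = ⊥-elim (subst T eq′ (ℕP.≡⇒≡ᵇ _ _ x≡k))

    t-elsewhere : x %ℕ n ≢ j %ℕ n → x %ℕ n ≢ k %ℕ n → t n j k x ≡ x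
    t-elsewhere x≢j x≢k with x %ℕ n ℕ.≡ᵇ j %ℕ n in eq
    ... | true  = ⊥-elim (x≢j (ℕP.≡ᵇ⇒≡ _ _ (subst T (sym eq) _)))
    ... | false with x %ℕ n ℕ.≡ᵇ k %ℕ n in eq′
    ...   | true  = ⊥-elim (x≢k (ℕP.≡ᵇ⇒≡ _ _ (subst T (sym eq′) _)))
    ...   | false = refl

  small-multiple≡0 : ∀ n (c : ℤ) d → d ℕ.< n → + d ≡ c * + n → d ≡ 0
  small-multiple≡0 n (+ zero)  d d<n eq rewrite ℤP.*-zeroˡ (+ n) = ℤP.+-injective eq
  small-multiple≡0 n (+ suc m) d d<n eq rewrite sym (ℤP.pos-* (suc m) n) =
    ⊥-elim (ℕP.<⇒≱ d<n (subst (n ℕ.≤_) (sym (ℤP.+-injective eq)) (ℕP.m≤m+n n (m ℕ.* n))))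
  small-multiple≡0 (suc n) -[1+ m ] d d<n ()

  module Residues (n : ℕ) .{{_ : NonZero n}} where

    same-residue⇒multiple : ∀ a b → a %ℕ n ≡ b %ℕ n → Σ[ c ∈ ℤ ] a ≡ b + c * + n
    same-residue⇒multiple a b eq = a /ℕ n - b /ℕ n , (begin
      a                                                ≡⟨ a≡a%ℕn+[a/ℕn]*n a n ⟩
      + (a %ℕ n) + a /ℕ n * + n                        ≡⟨ cong (λ z → + z + a /ℕ n * + n) eq ⟩
      + (b %ℕ n) + a /ℕ n * + n                        ≡⟨ regroup (+ (b %ℕ n)) (a /ℕ n) (b /ℕ n) (+ n) ⟩
      + (b %ℕ n) + b /ℕ n * + n + (a /ℕ n - b /ℕ n) * + n ≡⟨ cong (_+ (a /ℕ n - b /ℕ n) * + n) (sym (a≡a%ℕn+[a/ℕn]*n b n)) ⟩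
      b + (a /ℕ n - b /ℕ n) * + n                      ∎)
      where open ≡-Reasoning
            regroup : ∀ r qa qb m → r + qa * m ≡ r + qb * m + (qa - qb) * m
            regroup = solve-∀

    residue-unique-≤ : ∀ {r r′} c c′ → r ℕ.≤ r′ → r′ ℕ.< n → + r + c * + n ≡ + r′ + c′ * + n → r ≡ r′
    residue-unique-≤ {r} c c′ r≤r′ r′<n eq with ℕP.m≤n⇒∃[o]m+o≡n r≤r′
    ... | d , refl = sym (trans (cong (r ℕ.+_) d≡0) (ℕP.+-identityʳ r))
      where
      d≡0 : d ≡ 0
      d≡0 = small-multiple≡0 n (c - c′) d (ℕP.≤-<-trans (ℕP.m≤n+m d r) r′<n) (begin
        + d                                      ≡⟨ isolate (+ r) (+ d) (c′ * + n) ⟩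
        + r + + d + c′ * + n - + r - c′ * + n    ≡⟨ cong (λ z → z + c′ * + n - + r - c′ * + n) (sym (ℤP.pos-+ r d)) ⟩
        + (r ℕ.+ d) + c′ * + n - + r - c′ * + n  ≡⟨ cong (λ z → z - + r - c′ * + n) (sym eq) ⟩
        + r + c * + n - + r - c′ * + n           ≡⟨ collect (+ r) c c′ (+ n) ⟩
        (c - c′) * + n                           ∎)
        where open ≡-Reasoning
              isolate : ∀ r d x → d ≡ r + d + x - r - x
              isolate = solve-∀
              collect : ∀ r c c′ m → r + c * m - r - c′ * m ≡ (c - c′) * m
              collect = solve-∀

    residue-unique : ∀ {r r′} c c′ → r ℕ.< n → r′ ℕ.< n → + r + c * + n ≡ + r′ + c′ * + n → r ≡ r′
    residue-unique {r} {r′} c c′ r<n r′<n eq with ℕP.≤-total r r′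
    ... | inj₁ r≤r′ = residue-unique-≤ c c′ r≤r′ r′<n eq
    ... | inj₂ r′≤r = sym (residue-unique-≤ c′ c r′≤r r<n (sym eq))

    %ℕ-+n : ∀ x → (x + + n) %ℕ n ≡ x %ℕ n
    %ℕ-+n x = sym (residue-unique (x /ℕ n + + 1) ((x + + n) /ℕ n) (n%ℕd<d x n) (n%ℕd<d (x + + n) n) (begin
      + (x %ℕ n) + (x /ℕ n + + 1) * + n    ≡⟨ distrib (+ (x %ℕ n)) (x /ℕ n) (+ n) ⟩
      + (x %ℕ n) + x /ℕ n * + n + + n      ≡⟨ cong (_+ + n) (sym (a≡a%ℕn+[a/ℕn]*n x n)) ⟩
      x + + n                              ≡⟨ a≡a%ℕn+[a/ℕn]*n (x + + n) n ⟩
      + ((x + + n) %ℕ n) + (x + + n) /ℕ n * + n ∎))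
      where open ≡-Reasoning
            distrib : ∀ r q m → r + (q + + 1) * m ≡ r + q * m + m
            distrib = solve-∀

    window-residue-injective : ∀ γ {i i′} → i ℕ.< n → i′ ℕ.< n → (γ + + i) %ℕ n ≡ (γ + + i′) %ℕ n → i ≡ i′
    window-residue-injective γ {i} {i′} i<n i′<n eq with same-residue⇒multiple (γ + + i) (γ + + i′) eq
    ... | c , γi≡ = residue-unique (+ 0) c i<n i′<n (begin
      + i + + 0 * + n    ≡⟨ ℤP.+-identityʳ (+ i) ⟩
      + i                ≡⟨ cancel γ (+ i) ⟩
      γ + + i - γ        ≡⟨ cong (_- γ) γi≡ ⟩
      γ + + i′ + c * + n - γ ≡⟨ cancel′ γ (+ i′) (c * + n) ⟩
      + i′ + c * + n     ∎)
      where open ≡-Reasoning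
            cancel : ∀ γ i → i ≡ γ + i - γ
            cancel = solve-∀
            cancel′ : ∀ γ i x → γ + i + x - γ ≡ i + x
            cancel′ = solve-∀

  module WindowTransposition (n : ℕ) .{{_ : NonZero n}} (γ : ℤ) (jj kk : ℕ) (jj<kk : jj ℕ.< kk) (kk<n : kk ℕ.< n) where
    open Residues n

    j k : ℤ
    j = γ + + jj
    k = γ + + kk

    τ : ℤ → ℤ
    τ = t n j k

    gap : ℕ
    gap = proj₁ (ℕP.m≤n⇒∃[o]m+o≡n (ℕP.<⇒≤ jj<kk))

    jj+gap≡kk : jj ℕ.+ gap ≡ kk
    jj+gap≡kk = proj₂ (ℕP.m≤n⇒∃[o]m+o≡n (ℕP.<⇒≤ jj<kk))

    gap≤n : gap ℕ.≤ n
    gap≤n = ℕP.≤-trans (ℕP.m≤n+m gap jj) (ℕP.≤-trans (ℕP.≤-reflexive jj+gap≡kk) (ℕP.<⇒≤ kk<n))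

    k-j≡gap : k - j ≡ + gap
    k-j≡gap = begin
      γ + + kk - (γ + + jj)           ≡⟨ cong (λ z → γ + + z - (γ + + jj)) (sym jj+gap≡kk) ⟩
      γ + + (jj ℕ.+ gap) - (γ + + jj) ≡⟨ cong (λ z → γ + z - (γ + + jj)) (ℤP.pos-+ jj gap) ⟩
      γ + (+ jj + + gap) - (γ + + jj) ≡⟨ cancel γ (+ jj) (+ gap) ⟩
      + gap                           ∎
      where open ≡-Reasoning
            cancel : ∀ a b c → a + (b + c) - (a + b) ≡ c
            cancel = solve-∀

    j≢k-mod : ¬ (j ≡[ n ] k)
    j≢k-mod eq = ℕP.<⇒≢ jj<kk (window-residue-injective γ (ℕP.<-trans jj<kk kk<n) kk<n eq)

    τ-window : ∀ i → i ℕ.< n → τ (γ + + i) ≡ γ + + swap jj kk i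
    τ-window i i<n with swap-cases jj kk i
    ... | at-left refl = begin
      τ j                 ≡⟨ t-at-j n j k j refl ⟩
      j + (k - j)         ≡⟨ solve₁ j k ⟩
      k                   ≡⟨ cong (λ z → γ + + z) (sym (swap-left jj kk)) ⟩
      γ + + swap jj kk jj ∎
      where open ≡-Reasoning
            solve₁ : ∀ j k → j + (k - j) ≡ k
            solve₁ = solve-∀
    ... | at-right kk≢jj refl = begin
      τ k                 ≡⟨ t-at-k n j k k (λ eq → j≢k-mod (sym eq)) refl ⟩
      k - (k - j)         ≡⟨ solve₂ j k ⟩
      j                   ≡⟨ cong (λ z → γ + + z) (sym (swap-right (≢-sym kk≢jj))) ⟩
      γ + + swap jj kk kk ∎
      where open ≡-Reasoning
            solve₂ : ∀ j k → k - (k - j) ≡ j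
            solve₂ = solve-∀
    ... | elsewhere i≢jj i≢kk = trans
      (t-elsewhere n j k (γ + + i) (λ eq → i≢jj (window-residue-injective γ i<n (ℕP.<-trans jj<kk kk<n) eq))
                                    (λ eq → i≢kk (window-residue-injective γ i<n kk<n eq)))
      (cong (λ z → γ + + z) (sym (swap-other i≢jj i≢kk)))

    τ-periodic : ∀ x → τ (x + + n) ≡ τ x + + n
    τ-periodic x with x %ℕ n ℕP.≟ j %ℕ n
    ... | yes x≡j = trans (t-at-j n j k (x + + n) (trans (%ℕ-+n x) x≡j))
                          (trans (comm₁ x (+ n) (k - j)) (cong (_+ + n) (sym (t-at-j n j k x x≡j))))
      where comm₁ : ∀ a b c → a + b + c ≡ a + c + b
            comm₁ = solve-∀
    ... | no x≢j with x %ℕ n ℕP.≟ k %ℕ n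
    ...   | yes x≡k = trans (t-at-k n j k (x + + n) (λ eq → x≢j (trans (sym (%ℕ-+n x)) eq)) (trans (%ℕ-+n x) x≡k))
                            (trans (comm₂ x (+ n) (k - j)) (cong (_+ + n) (sym (t-at-k n j k x x≢j x≡k))))
      where comm₂ : ∀ a b c → a + b - c ≡ a - c + b
            comm₂ = solve-∀
    ...   | no x≢k = trans (t-elsewhere n j k (x + + n) (λ eq → x≢j (trans (sym (%ℕ-+n x)) eq))
                                                        (λ eq → x≢k (trans (sym (%ℕ-+n x)) eq)))
                           (cong (_+ + n) (sym (t-elsewhere n j k x x≢j x≢k)))

    τ-displacement : ∀ x → τ x ≤ x + + n × x ≤ τ x + + n
    τ-displacement x with x %ℕ n ℕP.≟ j %ℕ n
    ... | yes x≡j rewrite t-at-j n j k x x≡j | k-j≡gap =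
          ℤP.+-monoʳ-≤ x (ℤ.+≤+ gap≤n) , ≡+⇒≤ (gap ℕ.+ n) (trans (ℤP.+-assoc x _ _) (cong (λ z → x + z) (sym (ℤP.pos-+ gap n))))
    ... | no x≢j with x %ℕ n ℕP.≟ k %ℕ n
    ...   | yes x≡k rewrite t-at-k n j k x x≢j x≡k | k-j≡gap =
            ≡+⇒≤ (gap ℕ.+ n) (trans (regroup x (+ gap) (+ n)) (cong (λ z → x - + gap + z) (sym (ℤP.pos-+ gap n)))) ,
            subst (_≤ x - + gap + + n) (cancel x (+ gap)) (ℤP.+-monoʳ-≤ (x - + gap) (ℤ.+≤+ gap≤n))
      where regroup : ∀ a b c → a + c ≡ a - b + (b + c)
            regroup = solve-∀
            cancel : ∀ a b → a - b + b ≡ a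
            cancel = solve-∀
    ...   | no x≢k rewrite t-elsewhere n j k x x≢j x≢k = ℤP.i≤i+j x (+ n) , ℤP.i≤i+j x (+ n)


module LengthFormula where

  open import Data.Nat as ℕ using (ℕ; zero; suc; NonZero)
  import Data.Nat.Properties as ℕP
  import Data.Nat.Tactic.RingSolver as ℕSolver
  open import Data.Integer as ℤ using (ℤ; +_; _+_; _-_; -_; _≤_; _<_)
  import Data.Integer.Properties as ℤP
  open import Data.Integer.Tactic.RingSolver using (solve-∀)
  open import Data.Sum using (inj₁; inj₂)
  open import Data.Product using (_,_)
  open import Relation.Binary.PropositionalEquality
  open FiniteSums
  open WindowInversions
  open PeriodicCounts
  open IntegerOffsets
  open PeriodicDisplacement
  open InversionLists

  ⟦⟧-+-cancelʳ : ∀ a b c → ⟦ a + c < b + c ⟧ ≡ ⟦ a < b ⟧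
  ⟦⟧-+-cancelʳ a b c = indicator-cong _ _
    (λ lt → subst₂ _<_ (cancel a c) (cancel b c) (ℤP.+-monoˡ-< (- c) lt))
    (ℤP.+-monoˡ-< c)
    where cancel : ∀ a c → a + c + - c ≡ a
          cancel = solve-∀

  ∑-rotate : ∀ n a (G : ℕ → ℕ) → a ℕ.< n →
    ∑ (λ i → G (suc a ℕ.+ i)) 0 n ≡ ∑ (λ p → when< a p (G p) ℕ.+ unless< a p (G (p ℕ.+ n))) 0 n
  ∑-rotate n a G a<n with ℕP.m≤n⇒∃[o]m+o≡n a<n
  ... | r , refl = begin
    ∑ (λ i → G (suc a ℕ.+ i)) 0 (suc a ℕ.+ r)
      ≡⟨ cong (∑ (λ i → G (suc a ℕ.+ i)) 0) (ℕP.+-comm (suc a) r) ⟩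
    ∑ (λ i → G (suc a ℕ.+ i)) 0 (r ℕ.+ suc a)
      ≡⟨ ∑-split _ 0 r (suc a) ⟩
    ∑ (λ i → G (suc a ℕ.+ i)) 0 r ℕ.+ ∑ (λ i → G (suc a ℕ.+ i)) r (suc a)
      ≡⟨ cong₂ ℕ._+_ tail head ⟩
    ∑ G (suc a) r ℕ.+ ∑ (λ p → G (p ℕ.+ (suc a ℕ.+ r))) 0 (suc a)
      ≡⟨ ℕP.+-comm (∑ G (suc a) r) _ ⟩
    ∑ (λ p → G (p ℕ.+ (suc a ℕ.+ r))) 0 (suc a) ℕ.+ ∑ G (suc a) r
      ≡⟨ cong₂ ℕ._+_ (∑-cong 0 (suc a) λ p _ p≤a → sym (wrapped p (ℕP.≤-pred p≤a)))
                     (∑-cong (suc a) r λ p a<p _ → sym (unwrapped p a<p)) ⟩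
    ∑ S 0 (suc a) ℕ.+ ∑ S (suc a) r
      ≡⟨ sym (∑-split S 0 (suc a) r) ⟩
    ∑ S 0 (suc a ℕ.+ r) ∎
    where
    open ≡-Reasoning
    S : ℕ → ℕ
    S p = when< a p (G p) ℕ.+ unless< a p (G (p ℕ.+ (suc a ℕ.+ r)))
    tail : ∑ (λ i → G (suc a ℕ.+ i)) 0 r ≡ ∑ G (suc a) r
    tail = trans (∑-shift G (suc a) 0 r) (cong (λ z → ∑ G z r) (ℕP.+-identityʳ (suc a)))
    head : ∑ (λ i → G (suc a ℕ.+ i)) r (suc a) ≡ ∑ (λ p → G (p ℕ.+ (suc a ℕ.+ r))) 0 (suc a)
    head = sym (trans (∑-cong′ 0 (suc a) (λ p → cong G (reorder a r p)))
                      (trans (∑-shift (λ i → G (suc a ℕ.+ i)) r 0 (suc a))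
                             (cong (λ z → ∑ (λ i → G (suc a ℕ.+ i)) z (suc a)) (ℕP.+-identityʳ r))))
      where reorder : ∀ a r p → p ℕ.+ (suc a ℕ.+ r) ≡ suc a ℕ.+ (r ℕ.+ p)
            reorder = ℕSolver.solve-∀
    wrapped : ∀ p → p ℕ.≤ a → S p ≡ G (p ℕ.+ (suc a ℕ.+ r))
    wrapped p p≤a = cong₂ ℕ._+_ (when<-no _ (ℕP.≤⇒≯ p≤a)) (unless<-no _ (ℕP.≤⇒≯ p≤a))
    unwrapped : ∀ p → a ℕ.< p → S p ≡ G p
    unwrapped p a<p = trans (cong₂ ℕ._+_ (when<-yes _ a<p) (unless<-yes _ a<p)) (ℕP.+-identityʳ _)

  module PeriodicLength (n : ℕ) .{{_ : NonZero n}} (M′ : ℕ) (h : ℤ → ℤ) (periodic : ∀ i → h (i + + n) ≡ h i + + n) where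
    open Periodic n h periodic using (periodic-ℕ)

    N : ℕ
    N = suc M′ ℕ.* n

    open InversionList n N h using (inversionsAt)

    inversionsAt-periodic : ∀ x → inversionsAt (x + + n) ≡ inversionsAt x
    inversionsAt-periodic x = ∑-cong′ 1 N λ i → trans
      (cong₂ ⟦_<_⟧ (trans (cong h (comm x (+ n) (+ i))) (periodic (x + + i))) (periodic x))
      (⟦⟧-+-cancelʳ _ _ (+ n))
      where comm : ∀ a b c → a + b + c ≡ a + c + b
            comm = solve-∀

    windowSum : ℤ → ℕ
    windowSum x = ∑ (λ i → inversionsAt (x + + i)) 0 n

    windowSum-step : ∀ x → windowSum (x + + 1) ≡ windowSum x
    windowSum-step x = begin
      ∑ (λ i → inversionsAt (x + + 1 + + i)) 0 n ≡⟨ ∑-cong′ 0 n (λ i → cong inversionsAt (+ℕ-assoc x 1 i)) ⟩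
      ∑ (λ i → f (1 ℕ.+ i)) 0 n                  ≡⟨ ∑-shift f 1 0 n ⟩
      ∑ f 1 n                                    ≡⟨ cong (∑ f 1) (sym n≡) ⟩
      ∑ f 1 (suc n′)                             ≡⟨ ∑-snoc f 1 n′ ⟩
      ∑ f 1 n′ ℕ.+ f (suc n′)                    ≡⟨ cong (λ z → ∑ f 1 n′ ℕ.+ inversionsAt (x + + z)) n≡ ⟩
      ∑ f 1 n′ ℕ.+ inversionsAt (x + + n)        ≡⟨ cong (∑ f 1 n′ ℕ.+_) (trans (inversionsAt-periodic x) (cong inversionsAt (sym (ℤP.+-identityʳ x)))) ⟩
      ∑ f 1 n′ ℕ.+ f 0                           ≡⟨ ℕP.+-comm _ (f 0) ⟩
      ∑ f 0 (suc n′)                             ≡⟨ cong (∑ f 0) n≡ ⟩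
      windowSum x                                ∎
      where
      open ≡-Reasoning
      f : ℕ → ℕ
      f i = inversionsAt (x + + i)
      n′ : ℕ
      n′ = ℕ.pred n
      n≡ : suc n′ ≡ n
      n≡ = ℕP.suc-pred n

    windowSum-+ℕ : ∀ x m → windowSum (x + + m) ≡ windowSum x
    windowSum-+ℕ x zero    = cong windowSum (ℤP.+-identityʳ x)
    windowSum-+ℕ x (suc m) = begin
      windowSum (x + + suc m)   ≡⟨ cong windowSum (trans (cong (λ z → x + + z) (ℕP.+-comm 1 m)) (sym (+ℕ-assoc x m 1))) ⟩
      windowSum (x + + m + + 1) ≡⟨ windowSum-step (x + + m) ⟩
      windowSum (x + + m)       ≡⟨ windowSum-+ℕ x m ⟩
      windowSum x               ∎
      where open ≡-Reasoning

    windowSum-const : ∀ x y → windowSum x ≡ windowSum y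
    windowSum-const x y with ℤP.≤-total x y
    ... | inj₁ x≤y with ≤⇒≡+ x≤y
    ...   | d , refl = sym (windowSum-+ℕ x d)
    windowSum-const x y | inj₂ y≤x with ≤⇒≡+ y≤x
    ...   | d , refl = windowSum-+ℕ y d

    module _ (γ : ℤ) where

      private
        u : ℕ → ℤ
        u p = h (γ + + p)

      inversionsAt-periodicRow : ∀ a → a ℕ.< n → inversionsAt (γ + + a) ≡ Copies.periodicRow n u (suc M′) a
      inversionsAt-periodicRow a a<n = begin
        inversionsAt (γ + + a)                       ≡⟨ ∑-chunks f 1 n 0 (suc M′) ⟩
        ∑ (λ c → ∑ f (1 ℕ.+ c ℕ.* n) n) 0 (suc M′)   ≡⟨ ∑-cong′ 0 (suc M′) chunk ⟩
        Copies.periodicRow n u (suc M′) a            ∎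
        where
        open ≡-Reasoning
        f : ℕ → ℕ
        f i = ⟦ h (γ + + a + + i) < h (γ + + a) ⟧
        chunk : ∀ c → ∑ f (1 ℕ.+ c ℕ.* n) n ≡ Copies.laterHits n u a c ℕ.+ Copies.earlierHits n u a (suc c)
        chunk c = begin
          ∑ f (1 ℕ.+ c ℕ.* n) n
            ≡⟨ cong (λ z → ∑ f z n) (sym (ℕP.+-identityʳ _)) ⟩
          ∑ f (1 ℕ.+ c ℕ.* n ℕ.+ 0) n
            ≡⟨ sym (∑-shift f (1 ℕ.+ c ℕ.* n) 0 n) ⟩
          ∑ (λ i → f (1 ℕ.+ c ℕ.* n ℕ.+ i)) 0 n
            ≡⟨ ∑-cong′ 0 n (λ i → cong (λ z → ⟦ z < u a ⟧) (shifted i)) ⟩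
          ∑ (λ i → hit (suc a ℕ.+ i)) 0 n
            ≡⟨ ∑-rotate n a hit a<n ⟩
          ∑ (λ p → when< a p (hit p) ℕ.+ unless< a p (hit (p ℕ.+ n))) 0 n
            ≡⟨ ∑-cong′ 0 n (λ p → cong (λ z → when< a p (hit p) ℕ.+ unless< a p ⟦ z < u a ⟧) (next-copy p)) ⟩
          ∑ (λ p → when< a p (hit p) ℕ.+ unless< a p ⟦ u p + + (suc c ℕ.* n) < u a ⟧) 0 n
            ≡⟨ ∑-distrib-+ _ _ 0 n ⟩
          Copies.laterHits n u a c ℕ.+ Copies.earlierHits n u a (suc c) ∎
          where
          hit : ℕ → ℕ
          hit q = ⟦ u q + + (c ℕ.* n) < u a ⟧
          reorder : ∀ a c n i → a ℕ.+ (1 ℕ.+ c ℕ.* n ℕ.+ i) ≡ suc a ℕ.+ i ℕ.+ c ℕ.* n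
          reorder = ℕSolver.solve-∀
          shifted : ∀ i → h (γ + + a + + (1 ℕ.+ c ℕ.* n ℕ.+ i)) ≡ u (suc a ℕ.+ i) + + (c ℕ.* n)
          shifted i = begin
            h (γ + + a + + (1 ℕ.+ c ℕ.* n ℕ.+ i))    ≡⟨ cong h (+ℕ-assoc γ a _) ⟩
            h (γ + + (a ℕ.+ (1 ℕ.+ c ℕ.* n ℕ.+ i)))  ≡⟨ cong (λ z → h (γ + + z)) (reorder a c n i) ⟩
            h (γ + + (suc a ℕ.+ i ℕ.+ c ℕ.* n))      ≡⟨ cong h (sym (+ℕ-assoc γ (suc a ℕ.+ i) (c ℕ.* n))) ⟩
            h (γ + + (suc a ℕ.+ i) + + (c ℕ.* n))    ≡⟨ periodic-ℕ (γ + + (suc a ℕ.+ i)) c ⟩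
            u (suc a ℕ.+ i) + + (c ℕ.* n)            ∎
          next-copy : ∀ p → u (p ℕ.+ n) + + (c ℕ.* n) ≡ u p + + (suc c ℕ.* n)
          next-copy p = begin
            h (γ + + (p ℕ.+ n)) + + (c ℕ.* n) ≡⟨ cong (λ z → h z + + (c ℕ.* n)) (sym (+ℕ-assoc γ p n)) ⟩
            h (γ + + p + + n) + + (c ℕ.* n)   ≡⟨ cong (_+ + (c ℕ.* n)) (periodic (γ + + p)) ⟩
            h (γ + + p) + + n + + (c ℕ.* n)   ≡⟨ +ℕ-assoc (h (γ + + p)) n (c ℕ.* n) ⟩
            u p + + (suc c ℕ.* n)             ∎

      length-periodicTotal : ∑ (λ k → inversionsAt (+ k)) 1 n ≡ Copies.periodicTotal n u (suc M′)
      length-periodicTotal = begin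
        ∑ (λ k → inversionsAt (+ k)) 1 n ≡⟨ sym (∑-shift (λ k → inversionsAt (+ k)) 1 0 n) ⟩
        windowSum (+ 1)                  ≡⟨ windowSum-const (+ 1) γ ⟩
        windowSum γ                      ≡⟨ ∑-cong 0 n (λ a _ a<n → inversionsAt-periodicRow a a<n) ⟩
        Copies.periodicTotal n u (suc M′) ∎
        where open ≡-Reasoning


module CoveringTranspositions where

  open import Data.Nat as ℕ using (ℕ; suc; NonZero)
  import Data.Nat.Properties as ℕP
  import Data.Nat.Tactic.RingSolver as ℕSolver
  open import Data.Integer as ℤ using (ℤ; +_; _+_; _≤_; _<_)
  import Data.Integer.Properties as ℤP
  open import Data.Integer.Tactic.RingSolver using (solve-∀)
  open import Data.Product using (_,_; proj₁; proj₂)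
  open import Relation.Nullary using (¬_)
  open import Relation.Binary.PropositionalEquality
  open import Defs using (LengthDrop)
  open FiniteSums
  open WindowInversions
  open PeriodicCounts
  open IntegerOffsets
  open PeriodicDisplacement
  open InversionLists
  open Transpositions
  open LengthFormula

  module _ (n : ℕ) .{{_ : NonZero n}} (w : ℤ → ℤ) (periodic : ∀ i → w (i + + n) ≡ w i + + n) where
    open Periodic n w periodic using (maxDisplacement; inversion-span; periodic-ℕ)

    -- N ≥ G₂ + 2n exceeds the span of every inversion of w and of w ∘ τ, and no window value
    -- exceeds a window value shifted up by N.
    private
      G₂ M′ N : ℕ
      G₂ = maxDisplacement ℕ.+ maxDisplacement
      M′ = G₂ ℕ.+ 2
      N  = suc M′ ℕ.* n

      N-large : G₂ ℕ.+ n ℕ.+ n ℕ.≤ N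
      N-large = subst (λ m → G₂ ℕ.+ m ℕ.+ m ℕ.≤ suc M′ ℕ.* m) (ℕP.suc-pred n) (expand G₂ (ℕ.pred n))
        where
        expand : ∀ A k → A ℕ.+ suc k ℕ.+ suc k ℕ.≤ suc (A ℕ.+ 2) ℕ.* suc k
        expand A k = subst (A ℕ.+ suc k ℕ.+ suc k ℕ.≤_) (sym (eq A k)) (ℕP.m≤m+n _ _)
          where eq : ∀ A k → suc (A ℕ.+ 2) ℕ.* suc k ≡ A ℕ.+ suc k ℕ.+ suc k ℕ.+ (A ℕ.* k ℕ.+ k ℕ.+ 1)
                eq = ℕSolver.solve-∀

    module _ (γ : ℤ) (jj kk : ℕ) (jj<kk : jj ℕ.< kk) (kk<n : kk ℕ.< n) where
      open WindowTransposition n γ jj kk jj<kk kk<n using (τ; τ-window; τ-periodic; τ-displacement; j≢k-mod)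

      private
        wτ : ℤ → ℤ
        wτ x = w (τ x)

        wτ-periodic : ∀ i → wτ (i + + n) ≡ wτ i + + n
        wτ-periodic i = trans (cong w (τ-periodic i)) (periodic (τ i))

        v : ℕ → ℤ
        v p = w (γ + + p)

      w-span : ∀ x y → x < y → w y < w x → y ≤ x + + N
      w-span x y _ wy<wx = ℤP.≤-trans (inversion-span x y wy<wx)
        (+ℕ-mono-≤ x (ℕP.≤-trans (ℕP.m≤m+n G₂ n) (ℕP.≤-trans (ℕP.m≤m+n (G₂ ℕ.+ n) n) N-large)))

      wτ-span : ∀ x y → x < y → wτ y < wτ x → y ≤ x + + N
      wτ-span x y _ wτy<wτx = begin
        y                     ≤⟨ proj₂ (τ-displacement y) ⟩
        τ y + + n             ≤⟨ ℤP.+-monoˡ-≤ (+ n) (inversion-span (τ x) (τ y) wτy<wτx) ⟩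
        τ x + + G₂ + + n      ≤⟨ ℤP.+-monoˡ-≤ (+ n) (ℤP.+-monoˡ-≤ (+ G₂) (proj₁ (τ-displacement x))) ⟩
        x + + n + + G₂ + + n  ≡⟨ regroup x n G₂ ⟩
        x + + (G₂ ℕ.+ n ℕ.+ n) ≤⟨ +ℕ-mono-≤ x N-large ⟩
        x + + N               ∎
        where
        open ℤP.≤-Reasoning
        regroup : ∀ x n g → x + + n + + g + + n ≡ x + + (g ℕ.+ n ℕ.+ n)
        regroup x n g rewrite ℤP.pos-+ (g ℕ.+ n) n | ℤP.pos-+ g n = comm x (+ n) (+ g)
          where comm : ∀ x a b → x + a + b + a ≡ x + (b + a + a)
                comm = solve-∀

      window-separated : ∀ a p → a ℕ.< n → p ℕ.< n → ¬ (v p + + N < v a)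
      window-separated a p a<n p<n lt = ℕP.<⇒≱ a+G₂<N (ℕP.≤-trans (ℕP.m≤n+m N p) span)
        where
        shifted : w (γ + + (p ℕ.+ N)) ≡ v p + + N
        shifted = trans (cong w (sym (+ℕ-assoc γ p N))) (periodic-ℕ (γ + + p) (suc M′))
        span : p ℕ.+ N ℕ.≤ a ℕ.+ G₂
        span = +ℕ-cancel-≤ γ (subst (γ + + (p ℕ.+ N) ≤_) (+ℕ-assoc γ a G₂)
                 (inversion-span (γ + + a) (γ + + (p ℕ.+ N)) (subst (_< v a) (sym shifted) lt)))
        a+G₂<N : a ℕ.+ G₂ ℕ.< N
        a+G₂<N = ℕP.<-≤-trans (ℕP.+-monoˡ-< G₂ a<n)
                   (ℕP.≤-trans (ℕP.≤-reflexive (ℕP.+-comm n G₂)) (ℕP.≤-trans (ℕP.m≤m+n (G₂ ℕ.+ n) n) N-large))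

      covering⇒LengthDrop : w (γ + + kk) < w (γ + + jj) → (∀ q → jj ℕ.< q → q ℕ.< kk → w (γ + + q) < w (γ + + kk)) →
                   LengthDrop n w (γ + + jj) (γ + + kk)
      covering⇒LengthDrop wk<wj covered = j≢k-mod , L , L′ , InversionList.hasLength n N w w-span
                                                , InversionList.hasLength n N wτ wτ-span , drop
        where
        L L′ : ℕ
        L  = ∑ (λ k → InversionList.inversionsAt n N w (+ k)) 1 n
        L′ = ∑ (λ k → InversionList.inversionsAt n N wτ (+ k)) 1 n
        drop : L′ ℕ.+ 1 ≡ L
        drop = begin
          L′ ℕ.+ 1
            ≡⟨ cong (ℕ._+ 1) (PeriodicLength.length-periodicTotal n M′ wτ wτ-periodic γ) ⟩
          Copies.periodicTotal n (λ p → wτ (γ + + p)) (suc M′) ℕ.+ 1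
            ≡⟨ cong (ℕ._+ 1) (periodicTotal-cong n (suc M′) (λ p p<n → cong w (τ-window p p<n))) ⟩
          Copies.periodicTotal n (λ p → v (swap jj kk p)) (suc M′) ℕ.+ 1
            ≡⟨ periodicTotal-transposition M′ v jj<kk kk<n wk<wj covered window-separated ⟩
          Copies.periodicTotal n v (suc M′)
            ≡⟨ sym (PeriodicLength.length-periodicTotal n M′ w periodic γ) ⟩
          L ∎
          where open ≡-Reasoning


module BlockGraph where

  open import Data.Nat as ℕ using (ℕ; zero; suc; s≤s; z≤n; z<s; NonZero)
  import Data.Nat.Properties as ℕP
  open import Data.Integer as ℤ using (ℤ; +_; _+_; _≤_; _<_)
  import Data.Integer.Properties as ℤP
  open import Data.Fin as Fin using (Fin; toℕ)
  import Data.Fin.Properties as FinP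
  open import Data.Empty using (⊥-elim)
  open import Data.Sum using (_⊎_; inj₁; inj₂)
  open import Data.Product using (Σ-syntax; _,_; ∃; _×_; proj₁; proj₂; map₁; map₂)
  open import Function using (_∘_; _⇔_; Equivalence)
  open import Relation.Nullary using (Dec; yes; no; ¬_; ¬?)
  open import Relation.Nullary.Decidable using (decidable-stable)
  open import Data.Nat.Induction using (<-rec)
  open import Data.List using (List; []; _∷_; length)
  open import Data.List.Membership.Propositional using (_∈_)
  open import Data.List.Relation.Unary.Any using (here; there)
  open import Data.List.Relation.Unary.All as All using (All; []; _∷_)
  open import Data.List.Relation.Unary.Unique.Propositional using (Unique)
  open import Data.List.Relation.Unary.AllPairs using (_∷_; [])
  open FiniteSums
  open import Relation.Binary.PropositionalEquality
  open import Defs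
  open IntegerOffsets
  open CoveringTranspositions

  greatest-≤ : ∀ {P : ℕ → Set} → (∀ q → Dec (P q)) → ∀ m → P 0 →
               Σ[ r ∈ ℕ ] (r ℕ.≤ m × P r × (∀ r′ → r ℕ.< r′ → r′ ℕ.≤ m → ¬ P r′))
  greatest-≤ P? zero    P0 = 0 , z≤n , P0 , λ r′ 0<r′ r′≤0 → ⊥-elim (ℕP.<⇒≱ 0<r′ r′≤0)
  greatest-≤ P? (suc m) P0 with P? (suc m)
  ... | yes Pm = suc m , ℕP.≤-refl , Pm , λ r′ m<r′ r′≤m → ⊥-elim (ℕP.<⇒≱ m<r′ r′≤m)
  ... | no ¬Pm with greatest-≤ P? m P0
  ...   | r , r≤m , Pr , above = r , ℕP.m≤n⇒m≤1+n r≤m , Pr , above′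
    where
    above′ : ∀ r′ → r ℕ.< r′ → r′ ℕ.≤ suc m → ¬ _
    above′ r′ r<r′ r′≤m with r′ ℕP.≟ suc m
    ... | yes refl = ¬Pm
    ... | no r′≢m  = above r′ r<r′ (ℕP.≤-pred (ℕP.≤∧≢⇒< r′≤m r′≢m))

  module _ {R : ℤ → ℤ → Set} where

    reach-trans : ∀ {x y z} → Reach R x y → Reach R y z → Reach R x z
    reach-trans here       q = q
    reach-trans (step e p) q = step e (reach-trans p q)

    reach-sym : ∀ {x y} → Reach R x y → Reach R y x
    reach-sym here               = here
    reach-sym (step (inj₁ e) p) = reach-trans (reach-sym p) (step (inj₂ e) here)
    reach-sym (step (inj₂ e) p) = reach-trans (reach-sym p) (step (inj₁ e) here)

  Increasing : ∀ {s} → (Fin (suc s) → ℤ) → Set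
  Increasing a = ∀ i j → i Fin.< j → a i < a j

  increasing⇒monotone : ∀ {s} {a : Fin (suc s) → ℤ} → Increasing a → ∀ i j → toℕ i ℕ.≤ toℕ j → a i ≤ a j
  increasing⇒monotone {a = a} inc i j i≤j with toℕ i ℕP.≟ toℕ j
  ... | yes i≡j rewrite FinP.toℕ-injective i≡j = ℤP.≤-refl
  ... | no i≢j  = ℤP.<⇒≤ (inc i j (ℕP.≤∧≢⇒< i≤j i≢j))

  nxt-skips : ∀ {s} {a : Fin (suc s) → ℤ} top → Increasing a → ∀ i p → a p ≤ a i ⊎ nxt a top i ≤ a p
  nxt-skips {zero}  top inc Fin.zero    Fin.zero    = inj₁ ℤP.≤-refl
  nxt-skips {suc s} top inc Fin.zero    Fin.zero    = inj₁ ℤP.≤-refl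
  nxt-skips {suc s} top inc Fin.zero    (Fin.suc p) = inj₂ (increasing⇒monotone inc (Fin.suc Fin.zero) (Fin.suc p) (s≤s z≤n))
  nxt-skips {suc s} top inc (Fin.suc i) Fin.zero    = inj₁ (increasing⇒monotone inc Fin.zero (Fin.suc i) z≤n)
  nxt-skips {suc s} top inc (Fin.suc i) (Fin.suc p) = nxt-skips top (λ i j i<j → inc (Fin.suc i) (Fin.suc j) (s≤s i<j)) i p

  nxt-cases : ∀ {s} (a : Fin (suc s) → ℤ) top i → nxt a top i ≡ top ⊎ Σ[ i′ ∈ Fin (suc s) ] (i Fin.< i′ × nxt a top i ≡ a i′)
  nxt-cases {zero}  a top Fin.zero    = inj₁ refl
  nxt-cases {suc s} a top Fin.zero    = inj₂ (Fin.suc Fin.zero , s≤s z≤n , refl)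
  nxt-cases {suc s} a top (Fin.suc i) with nxt-cases (a ∘ Fin.suc) top i
  ... | inj₁ eq              = inj₁ eq
  ... | inj₂ (i′ , i<i′ , eq) = inj₂ (Fin.suc i′ , s≤s i<i′ , eq)

  block-of : ∀ {s} (a : Fin (suc s) → ℤ) top x → a Fin.zero ≤ x → x < top → Σ[ i ∈ Fin (suc s) ] (a i ≤ x × x < nxt a top i)
  block-of {zero}  a top x a₀≤x x<top = Fin.zero , a₀≤x , x<top
  block-of {suc s} a top x a₀≤x x<top with x ℤP.<? a (Fin.suc Fin.zero)
  ... | yes x<a₁ = Fin.zero , a₀≤x , x<a₁
  ... | no x≮a₁ with block-of (a ∘ Fin.suc) top x (ℤP.≮⇒≥ x≮a₁) x<top
  ...   | i , ai≤x , x<nxt = Fin.suc i , ai≤x , x<nxt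

  module Blocks (n : ℕ) .{{_ : NonZero n}} (w : ℤ → ℤ) (affine : IsAffinePerm n w) (β : ℤ)
                (s : ℕ) (a : Fin (suc s) → ℤ) (increasing : Increasing a)
                (lrm : ∀ c → IsLRM n w β c ⇔ (∃ λ i → a i ≡ c)) where
    open IsAffinePerm affine

    top ar : ℤ
    top = β + + n
    ar  = last a

    Block : Fin (suc s) → ℤ → Set
    Block i j = V w β ar j × a i ≤ j × j < nxt a top i

    Edge : ℤ → ℤ → Set
    Edge = E n w β ar

    β<top : β < top
    β<top = subst (_< top) (ℤP.+-identityʳ β) (+ℕ-mono-< β (ℕ.>-nonZero⁻¹ n))

    a-isLRM : ∀ i → IsLRM n w β (a i)
    a-isLRM i = Equivalence.from (lrm (a i)) (i , refl)

    β≤a : ∀ i → β ≤ a i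
    β≤a i = proj₁ (a-isLRM i)

    a<top : ∀ i → a i < top
    a<top i = proj₁ (proj₂ (a-isLRM i))

    a-dominates : ∀ i e → β ≤ e → e < a i → w e < w (a i)
    a-dominates i = proj₂ (proj₂ (a-isLRM i))

    a₀≡β : a Fin.zero ≡ β
    a₀≡β with Equivalence.to (lrm β) (ℤP.≤-refl , β<top , λ e β≤e e<β → ⊥-elim (ℤP.<⇒≱ e<β β≤e))
    ... | i , ai≡β = ℤP.≤-antisym (subst (a Fin.zero ≤_) ai≡β (increasing⇒monotone increasing Fin.zero i z≤n)) (β≤a Fin.zero)

    nxt≤top : ∀ i → nxt a top i ≤ top
    nxt≤top i with nxt-cases a top i
    ... | inj₁ eq              = ℤP.≤-reflexive eq
    ... | inj₂ (i′ , _ , eq)   = subst (_≤ top) (sym eq) (ℤP.<⇒≤ (a<top i′))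

    wa≤war : ∀ i → w (a i) ≤ w ar
    wa≤war i with toℕ i ℕP.≟ s
    ... | yes i≡s rewrite FinP.toℕ-injective (trans i≡s (sym (FinP.toℕ-fromℕ s))) = ℤP.≤-refl
    ... | no i≢s  = ℤP.<⇒≤ (a-dominates (Fin.fromℕ s) (a i) (β≤a i)
                      (increasing i (Fin.fromℕ s) (subst (toℕ i ℕ.<_) (sym (FinP.toℕ-fromℕ s))
                                                    (ℕP.≤∧≢⇒< (ℕP.≤-pred (FinP.toℕ<n i)) i≢s))))

    inside-block-not-a : ∀ i y → a i < y → y < nxt a top i → ¬ (∃ λ p → a p ≡ y)
    inside-block-not-a i y ai<y y<nxt (p , refl) with nxt-skips top increasing i p
    ... | inj₁ ap≤ai  = ℤP.<⇒≱ ai<y ap≤ai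
    ... | inj₂ nxt≤ap = ℤP.<⇒≱ y<nxt nxt≤ap

    earlier-larger : ∀ y → β ≤ y → y < top → ¬ (∃ λ p → a p ≡ y) → Σ[ e ∈ ℤ ] (β ≤ e × e < y × w y < w e)
    earlier-larger y β≤y y<top not-a with ≤⇒≡+ β≤y
    ... | o , refl with ℕP.anyUpTo? (λ q → ¬? (w (β + + q) ℤP.<? w (β + + o))) o
    ...   | yes (q , q<o , ≮) = β + + q , ℤP.i≤i+j β (+ q) , +ℕ-mono-< β q<o ,
              ℤP.≤∧≢⇒< (ℤP.≮⇒≥ ≮) (λ eq → ℕP.<⇒≢ q<o (+ℕ-injectiveʳ β (injective _ _ (sym eq))))
    ...   | no none = ⊥-elim (not-a (Equivalence.to (lrm (β + + o)) (β≤y , y<top , is-lrm)))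
      where
      is-lrm : ∀ e → β ≤ e → e < β + + o → w e < w (β + + o)
      is-lrm e β≤e e<y with ≤⇒≡+ β≤e
      ... | q , refl = decidable-stable (_ ℤP.<? _) (λ ≮ → none (q , +ℕ-cancel-< β e<y , ≮))

    block-dominated : ∀ i y → a i ≤ y → y < nxt a top i → w y ≤ w (a i)
    block-dominated i y ai≤y y<nxt with ≤⇒≡+ ai≤y
    ... | d , refl = <-rec Dominated descend d y<nxt
      where
      Dominated : ℕ → Set
      Dominated d = a i + + d < nxt a top i → w (a i + + d) ≤ w (a i)
      descend : ∀ d → (∀ {d′} → d′ ℕ.< d → Dominated d′) → Dominated d
      descend zero    _   _     = ℤP.≤-reflexive (cong w (ℤP.+-identityʳ (a i)))
      descend (suc d) rec y<nxt
        with earlier-larger (a i + + suc d) (ℤP.≤-trans (β≤a i) (ℤP.i≤i+j (a i) (+ suc d)))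
                            (ℤP.<-≤-trans y<nxt (nxt≤top i))
                            (inside-block-not-a i _ (<+ℕsuc (a i) d) y<nxt)
      ... | e , β≤e , e<y , wy<we with e ℤP.<? a i
      ...   | yes e<ai = ℤP.<⇒≤ (ℤP.<-trans wy<we (a-dominates i e β≤e e<ai))
      ...   | no e≮ai with ≤⇒≡+ (ℤP.≮⇒≥ e≮ai)
      ...     | d′ , refl = ℤP.<⇒≤ (ℤP.<-≤-trans wy<we (rec (+ℕ-cancel-< (a i) e<y) (ℤP.<-trans e<y y<nxt)))

    in-block : ∀ i {y} → a i ≤ y → y < nxt a top i → Block i y
    in-block i {y} ai≤y y<nxt = (ℤP.≤-trans (β≤a i) ai≤y , ℤP.≤-trans (block-dominated i y ai≤y y<nxt) (wa≤war i))
                              , ai≤y , y<nxt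

    -- The edge goes back to the last earlier position in the block whose value exceeds w x:
    -- every value strictly between them is below w x, so the transposition is a covering one.
    edge-to-earlier : ∀ i x → Block i x → a i < x → Σ[ e ∈ ℤ ] (Block i e × e < x × Edge e x)
    edge-to-earlier i x (x∈V , ai≤x , x<nxt) ai<x with <⇒≡+suc ai<x | ≤⇒≡+ (β≤a i)
    ... | d , refl | α , ai≡ = e , e∈block , e<x , (proj₁ e∈block , x∈V , proj₁ (proj₁ e∈block) , ℤP.<-trans e<x x<top , e<x , drop)
      where
      x<top : x < top
      x<top = ℤP.<-≤-trans x<nxt (nxt≤top i)
      wx<wai : w x < w (a i + + 0)
      wx<wai = subst (λ z → w x < w z) (sym (ℤP.+-identityʳ (a i)))
        (ℤP.≤∧≢⇒< (block-dominated i x ai≤x x<nxt) (λ eq → ℤP.<⇒≢ ai<x (sym (injective _ _ eq))))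
      greatest : Σ[ r ∈ ℕ ] (r ℕ.≤ d × w x < w (a i + + r) × (∀ r′ → r ℕ.< r′ → r′ ℕ.≤ d → ¬ w x < w (a i + + r′)))
      greatest = greatest-≤ (λ r → w x ℤP.<? w (a i + + r)) d wx<wai
      r : ℕ
      r = proj₁ greatest
      r≤d : r ℕ.≤ d
      r≤d = proj₁ (proj₂ greatest)
      e : ℤ
      e = a i + + r
      wx<we : w x < w e
      wx<we = proj₁ (proj₂ (proj₂ greatest))
      beyond : ∀ r′ → r ℕ.< r′ → r′ ℕ.≤ d → ¬ w x < w (a i + + r′)
      beyond = proj₂ (proj₂ (proj₂ greatest))
      e<x : e < x
      e<x = +ℕ-mono-< (a i) (s≤s r≤d)
      e∈block : Block i e
      e∈block = in-block i (ℤP.i≤i+j (a i) (+ r)) (ℤP.<-trans e<x x<nxt)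
      from-β : ∀ m → a i + + m ≡ β + + (α ℕ.+ m)
      from-β m = trans (cong (_+ + m) ai≡) (+ℕ-assoc β α m)
      covered : ∀ q → α ℕ.+ r ℕ.< q → q ℕ.< α ℕ.+ suc d → w (β + + q) < w (β + + (α ℕ.+ suc d))
      covered q α+r<q q<α+d with ℕP.m≤n⇒∃[o]m+o≡n (ℕP.≤-trans (ℕP.m≤m+n α r) (ℕP.<⇒≤ α+r<q))
      ... | r′ , refl = subst₂ (λ y z → w y < w z) (from-β r′) (from-β (suc d))
        (ℤP.≤∧≢⇒< (ℤP.≮⇒≥ (beyond r′ (ℕP.+-cancelˡ-< α r r′ α+r<q) (ℕP.≤-pred r′<d)))
                  (λ eq → ℕP.<⇒≢ r′<d (+ℕ-injectiveʳ (a i) (injective _ _ eq))))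
        where r′<d : r′ ℕ.< suc d
              r′<d = ℕP.+-cancelˡ-< α r′ (suc d) q<α+d
      drop : LengthDrop n w e x
      drop = subst₂ (LengthDrop n w) (sym (from-β r)) (sym (from-β (suc d)))
        (covering⇒LengthDrop n w periodic β (α ℕ.+ r) (α ℕ.+ suc d) (ℕP.+-monoʳ-< α (s≤s r≤d))
          (+ℕ-cancel-< β (subst (_< top) (from-β (suc d)) x<top))
          (subst₂ (λ y z → w y < w z) (from-β (suc d)) (from-β r) wx<we) covered)

    reaches-start : ∀ i x → Block i x → Reach (Induced (Block i) Edge) x (a i)
    reaches-start i x x∈@(_ , ai≤x , _) with ≤⇒≡+ ai≤x
    ... | d , refl = <-rec Reaches descend d x∈
      where
      Reaches : ℕ → Set
      Reaches d = Block i (a i + + d) → Reach (Induced (Block i) Edge) (a i + + d) (a i)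
      descend : ∀ d → (∀ {d′} → d′ ℕ.< d → Reaches d′) → Reaches d
      descend zero    _   _  = subst (λ z → Reach (Induced (Block i) Edge) z (a i)) (sym (ℤP.+-identityʳ (a i))) here
      descend (suc d) rec x∈ with edge-to-earlier i _ x∈ (<+ℕsuc (a i) d)
      ... | e , e∈ , e<x , edge with ≤⇒≡+ (proj₁ (proj₂ e∈))
      ...   | d′ , refl = step (inj₂ (e∈ , x∈ , edge)) (rec (+ℕ-cancel-< (a i) e<x) e∈)

    blocks-connected : ∀ i → Connected (Block i) Edge
    blocks-connected i x y x∈ y∈ = reach-trans (reaches-start i x x∈) (reach-sym (reaches-start i y y∈))

    InBlockEdge : ℤ × ℤ → Set
    InBlockEdge (e , x) = Σ[ i ∈ Fin (suc s) ] Induced (Block i) Edge e x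

    isA? : ∀ y → Dec (∃ λ p → a p ≡ y)
    isA? y = FinP.any? (λ p → a p ℤP.≟ y)

    edge-into : ∀ o → o ℕ.< n → ¬ (∃ λ p → a p ≡ β + + o) → Σ[ e ∈ ℤ ] InBlockEdge (e , β + + o)
    edge-into o o<n not-a
      with block-of a top (β + + o) (subst (_≤ β + + o) (sym a₀≡β) (ℤP.i≤i+j β (+ o))) (+ℕ-mono-< β o<n)
    ... | i , ai≤x , x<nxt with edge-to-earlier i (β + + o) (in-block i ai≤x x<nxt) (ℤP.≤∧≢⇒< ai≤x (λ eq → not-a (i , eq)))
    ...   | e , e∈ , _ , edge = e , i , e∈ , in-block i ai≤x x<nxt , edge

    incoming : ∀ o m → o ℕ.+ m ℕ.≤ n → List (ℤ × ℤ)
    incoming o zero    _     = []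
    incoming o (suc m) o+m≤n with isA? (β + + o)
    ... | yes _     = incoming (suc o) m (subst (ℕ._≤ n) (ℕP.+-suc o m) o+m≤n)
    ... | no not-a  = (proj₁ (edge-into o (ℕP.<-≤-trans (ℕP.m<m+n o z<s) o+m≤n) not-a) , β + + o)
                      ∷ incoming (suc o) m (subst (ℕ._≤ n) (ℕP.+-suc o m) o+m≤n)

    incoming-edges : ∀ o m o+m≤n → All InBlockEdge (incoming o m o+m≤n)
    incoming-edges o zero    _ = []
    incoming-edges o (suc m) o+m≤n with isA? (β + + o)
    ... | yes _    = incoming-edges (suc o) m _
    ... | no not-a = proj₂ (edge-into o _ not-a) ∷ incoming-edges (suc o) m _

    incoming-targets : ∀ o m o+m≤n {p} → p ∈ incoming o m o+m≤n → Σ[ o′ ∈ ℕ ] (o ℕ.≤ o′ × proj₂ p ≡ β + + o′)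
    incoming-targets o (suc m) o+m≤n p∈ with isA? (β + + o) | p∈
    ... | yes _ | p∈′       = map₂ (map₁ ℕP.<⇒≤) (incoming-targets (suc o) m _ p∈′)
    ... | no _  | here refl = o , ℕP.≤-refl , refl
    ... | no _  | there p∈′ = map₂ (map₁ ℕP.<⇒≤) (incoming-targets (suc o) m _ p∈′)

    incoming-unique : ∀ o m o+m≤n → Unique (incoming o m o+m≤n)
    incoming-unique o zero    _ = []
    incoming-unique o (suc m) o+m≤n with isA? (β + + o)
    ... | yes _    = incoming-unique (suc o) m _
    ... | no not-a = All.tabulate fresh ∷ incoming-unique (suc o) m _
      where
      fresh : ∀ {p} → p ∈ incoming (suc o) m _ → _ ≢ p
      fresh p∈ eq with incoming-targets (suc o) m _ p∈
      ... | o′ , o<o′ , target = ℕP.<⇒≢ o<o′ (+ℕ-injectiveʳ β (trans (cong proj₂ eq) target))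

    incoming-length : ∀ o m o+m≤n → length (incoming o m o+m≤n) ≡ ∑ (λ o → indicator (¬? (isA? (β + + o)))) o m
    incoming-length o zero    _ = refl
    incoming-length o (suc m) o+m≤n with isA? (β + + o)
    ... | yes _ = incoming-length (suc o) m _
    ... | no _  = cong suc (incoming-length (suc o) m _)

    hits-at-most-once : ∀ c lo m → ∑ (λ o → indicator (c ℤP.≟ β + + o)) lo m ℕ.≤ 1
    hits-at-most-once c lo zero = z≤n
    hits-at-most-once c lo (suc m) with c ℤP.≟ β + + lo
    ... | yes refl = ℕP.≤-reflexive (cong suc (∑-zero _ (suc lo) m λ o lo<o _ →
                       indicator-no _ (λ eq → ℕP.<⇒≢ lo<o (+ℕ-injectiveʳ β eq))))
    ... | no _ = hits-at-most-once c (suc lo) m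

    a-positions≤ : ∑ (λ o → indicator (isA? (β + + o))) 0 n ℕ.≤ suc s
    a-positions≤ = begin
      ∑ (λ o → indicator (isA? (β + + o))) 0 n          ≤⟨ ∑-mono 0 n (λ o → isA≤ (β + + o)) ⟩
      ∑ (λ o → ∑ᶠ (λ p → indicator (a p ℤP.≟ β + + o))) 0 n ≡⟨ ∑-∑ᶠ-comm (λ o p → indicator (a p ℤP.≟ β + + o)) 0 n ⟩
      ∑ᶠ (λ p → ∑ (λ o → indicator (a p ℤP.≟ β + + o)) 0 n) ≤⟨ ∑ᶠ-mono (λ p → hits-at-most-once (a p) 0 n) ⟩
      ∑ᶠ {suc s} (λ _ → 1)                               ≡⟨ ∑ᶠ-one (suc s) ⟩
      suc s                                              ∎
      where
      open ℕP.≤-Reasoning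
      isA≤ : ∀ y → indicator (isA? y) ℕ.≤ ∑ᶠ (λ p → indicator (a p ℤP.≟ y))
      isA≤ y with isA? y
      ... | yes (p , ap≡y) = ℕP.≤-trans (ℕP.≤-reflexive (sym (indicator-yes (a p ℤP.≟ y) ap≡y)))
                                         (term≤∑ᶠ (λ p → indicator (a p ℤP.≟ y)) p)
      ... | no _           = z≤n

    many-incoming-edges : AtLeastEdges InBlockEdge (n ℕ.∸ suc s)
    many-incoming-edges = incoming 0 n ℕP.≤-refl , incoming-unique 0 n _ , incoming-edges 0 n _ , (begin
      n ℕ.∸ suc s                   ≤⟨ ℕP.∸-monoʳ-≤ n a-positions≤ ⟩
      n ℕ.∸ #a                      ≡⟨ cong (ℕ._∸ #a) (sym split) ⟩
      #non-a ℕ.+ #a ℕ.∸ #a          ≡⟨ ℕP.m+n∸n≡m #non-a #a ⟩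
      #non-a                        ≡⟨ sym (incoming-length 0 n _) ⟩
      length (incoming 0 n ℕP.≤-refl) ∎)
      where
      open ℕP.≤-Reasoning
      #a #non-a : ℕ
      #a     = ∑ (λ o → indicator (isA? (β + + o))) 0 n
      #non-a = ∑ (λ o → indicator (¬? (isA? (β + + o)))) 0 n
      split : #non-a ℕ.+ #a ≡ n
      split = trans (sym (∑-distrib-+ _ _ 0 n)) (trans (∑-cong′ 0 n (λ o → indicator-¬?-+ (isA? (β + + o)))) (∑-one 0 n))


open import Defs
open import Data.Nat as ℕ using (ℕ; suc; NonZero; _∸_)
open import Data.Integer using (ℤ; +_; _+_; _≤_; _<_)
open import Data.Fin as Fin using (Fin)
open import Data.Product using (Σ; ∃; _×_; _,_; map₁; map₂)
open import Relation.Binary.PropositionalEquality using (_≡_)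
open import Function using (_⇔_)
import Data.List.Relation.Unary.All as All
open BlockGraph

lemma4p4 : (n : ℕ) .{{_ : NonZero n}} (w : ℤ → ℤ) → IsAffinePerm n w →
    (β : ℤ) → (∀ i → i < β → w i < w β) →
    (s : ℕ) (a : Fin (suc s) → ℤ) →
    (∀ i j → i Fin.< j → a i < a j) →
    (∀ c → IsLRM n w β c ⇔ (∃ λ i → a i ≡ c)) →
    let ar = last a
        Block = λ (i : Fin (suc s)) (j : ℤ) → V w β ar j × a i ≤ j × j < nxt a (β + + n) i
    in (∀ i → Connected (Block i) (E n w β ar))
       × AtLeastEdges (λ { (j , k) → Σ (Fin (suc s)) λ i → Induced (Block i) (E n w β ar) j k })
                      (n ∸ suc s)
-- The hypothesis that w β exceeds all earlier values is not needed. The edge predicate of the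
-- statement is a pattern lambda, which reduces to InBlockEdge only on explicit pairs.
lemma4p4 n w affine β _ s a increasing lrm =
  blocks-connected , map₂ (map₂ (map₁ (All.map λ { {_ , _} edge → edge }))) many-incoming-edges
  where open Blocks n w affine β s a increasing lrm
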